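{- Let $G=U(T^*_{a_1,b_1},T^*_{0,b_2},\dots,T^*_{0,b_g})$ be a unicyclic graph of order $n$ with even girth $g$ and matching number $\beta\ge\frac{3g}{2}$, where $a_1,b_1$ are nonnegative integers, $b_j\in\{0,1\}$ for $j=2,\dots,g$, and $a_1=\beta-\frac g2$. Let $t=\sum_{i=2}^g b_i$. Then $$W(G)\ge W\big(U(T^*_{a_1,\,b_1+t},T^*_{0,0},\dots,T^*_{0,0})\big),$$ with equality if and only if $G=U(T^*_{a_1,\,b_1+t},T^*_{0,0},\dots,T^*_{0,0})$.
   Context: All graphs are finite, simple, undirected. $W(H)=\sum_{\{u,v\}\subseteq V(H)} d_H(u,v)$ is the Wiener index, $d_H$ the distance. The matching number is the maximum size of a matching. A unicyclic graph is a connected graph with exactly one cycle, its girth the cycle length. For a cycle $u_1\cdots u_g$ and vertex-disjoint rooted trees $T_1,\dots,T_g$, $U(T_1,\dots,T_g)$ is the graph obtained by identifying $u_i$ with the root of $T_i$. For nonnegative integers $a,b$, $T^*_{a,b}$ is the rooted tree of order $2a+b+1$ obtained from the star $K_{1,a+b}$ with root its center by attaching one new pendant vertex to each of $a$ of its leaves; $T^*_{0,0}$ is a single vertex and $T^*_{0,1}$ an edge rooted at an end. -}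

module Defs where

open import Data.Nat using (ℕ; zero; suc; _+_; _*_; _≤_; _<ᵇ_; _≡ᵇ_)
open import Data.Bool using (Bool; true; false; _∧_; _∨_; if_then_else_; T)
open import Data.Fin using (Fin; toℕ)
open import Data.List using (List; []; _∷_; _++_; map; length; allFin; concatMap)
open import Data.Nat.ListAction using (sum)
open import Data.Bool.ListAction using (any)
open import Data.List.Relation.Unary.All using (All)
open import Data.List.Relation.Unary.Unique.Propositional using (Unique)
open import Data.Product using (_×_; _,_; Σ; ∃)
open import Relation.Binary.PropositionalEquality using (_≡_)
open import Function.Bundles using (_↔_; Inverse; _⇔_)

record Graph : Set where
  constructor mkGraph
  field
    n     : ℕ
    edges : List (ℕ × ℕ)
open Graph public

adjb : (G : Graph) → Fin (n G) → Fin (n G) → Bool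
adjb G u v = any (λ { (x , y) → ((toℕ u ≡ᵇ x) ∧ (toℕ v ≡ᵇ y)) ∨ ((toℕ u ≡ᵇ y) ∧ (toℕ v ≡ᵇ x)) }) (edges G)

Adj : (G : Graph) → Fin (n G) → Fin (n G) → Set
Adj G u v = T (adjb G u v)

reach : (G : Graph) → ℕ → Fin (n G) → Fin (n G) → Bool
reach G zero    u v = toℕ u ≡ᵇ toℕ v
reach G (suc k) u v = reach G k u v ∨ any (λ w → adjb G u w ∧ reach G k w v) (allFin (n G))

-- distance: the least k with a u-v walk of length ≤ k
-- (search over k = 0 .. n; for connected graphs the distance is < n)
distSearch : (G : Graph) → Fin (n G) → Fin (n G) → ℕ → ℕ → ℕ
distSearch G u v k zero    = k
distSearch G u v k (suc f) = if reach G k u v then k else distSearch G u v (suc k) f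

dist : (G : Graph) → Fin (n G) → Fin (n G) → ℕ
dist G u v = distSearch G u v 0 (n G)

W : Graph → ℕ
W G = sum (map (λ u → sum (map (λ v → if toℕ u <ᵇ toℕ v then dist G u v else 0)
                                  (allFin (n G))))
               (allFin (n G)))

endpoints : {m : ℕ} → List (Fin m × Fin m) → List (Fin m)
endpoints = concatMap (λ { (x , y) → x ∷ y ∷ [] })

IsMatching : (G : Graph) → List (Fin (n G) × Fin (n G)) → Set
IsMatching G M = All (λ { (x , y) → Adj G x y }) M × Unique (endpoints M)

MatchingNumber : Graph → ℕ → Set
MatchingNumber G β =
  (Σ (List (Fin (n G) × Fin (n G))) λ M → IsMatching G M × length M ≡ β)
  × ((M : List (Fin (n G) × Fin (n G))) → IsMatching G M → length M ≤ β)

Iso : Graph → Graph → Set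
Iso G H = Σ (Fin (n G) ↔ Fin (n H)) λ f →
  (u v : Fin (n G)) → Adj G u v ⇔ Adj H (Inverse.to f u) (Inverse.to f v)

-- Rooted trees: vertex set {0,..,size-1}, root 0.

record RTree : Set where
  constructor mkRTree
  field
    size   : ℕ
    tedges : List (ℕ × ℕ)
open RTree public

-- T*_{a,b}: centre 0, leaves 1..a+b, and pendant vertex a+b+i attached
-- to leaf i for i = 1..a.  Order 2a+b+1.
range1 : ℕ → List ℕ
range1 zero    = []
range1 (suc k) = range1 k ++ (suc k ∷ [])

Tstar : ℕ → ℕ → RTree
Tstar a b = mkRTree (a + a + b + 1)
  (map (λ i → (0 , i)) (range1 (a + b)) ++ map (λ i → (i , a + b + i)) (range1 a))

-- U(T_1,...,T_g): the roots of T_1..T_g (in this order) form the cycle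
-- u_1 ... u_g.  Tree T_i occupies indices offset_i .. offset_i + size_i - 1.
shift : ℕ → List (ℕ × ℕ) → List (ℕ × ℕ)
shift o = map (λ { (x , y) → (o + x , o + y) })

roots : ℕ → List RTree → List ℕ
roots o []       = []
roots o (t ∷ ts) = o ∷ roots (o + size t) ts

treeEdges : ℕ → List RTree → List (ℕ × ℕ)
treeEdges o []       = []
treeEdges o (t ∷ ts) = shift o (tedges t) ++ treeEdges (o + size t) ts

pathEdges : List ℕ → List (ℕ × ℕ)
pathEdges []            = []
pathEdges (x ∷ [])      = []
pathEdges (x ∷ y ∷ rs)  = (x , y) ∷ pathEdges (y ∷ rs)

lastOr : ℕ → List ℕ → ℕ
lastOr d []       = d
lastOr d (x ∷ xs) = lastOr x xs

cycleEdges : List ℕ → List (ℕ × ℕ)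
cycleEdges []       = []
cycleEdges (r ∷ rs) = pathEdges (r ∷ rs) ++ ((lastOr r rs , r) ∷ [])

U : List RTree → Graph
U ts = mkGraph (sum (map size ts)) (cycleEdges (roots 0 ts) ++ treeEdges 0 ts)

-- Every vertex of U(T*_{a,b}, T*_{0,b₂}, …, T*_{0,b_g}) is described by its tree p, its depth
-- h ≤ 2 and its branch i, and the distance of two vertices is |h - k| on a common branch, h + k
-- within one tree and h + k + d_C(p, q) otherwise, d_C being the distance on the cycle.  This
-- turns the Wiener index into a sum over blocks of descriptors.  Passing from G to H moves the
-- t = b₂ + … + b_g leaves hanging from the other roots of the cycle into the first tree.  Since
-- a₁ ≥ g, the first tree has at least g + 2 more vertices than there are other roots, so each
-- moved leaf saves at least g + 2 in its distances to them, while the moved leaves end up at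
-- mutual distance at most 2.  As t ≤ g - 1 this gives W(H) + 3t ≤ W(G); equality forces t = 0, i.e.
-- G = H, and isomorphic graphs have the same Wiener index.

module Submission where

open import Defs
open import Data.Bool using (Bool; true; false; _∧_; _∨_; if_then_else_; T)
open import Data.Bool.Properties using (T-∧; T-∨)
open import Data.Bool.ListAction using (any)
open import Data.Empty using (⊥-elim)
open import Data.Fin using (Fin; toℕ; fromℕ<)
import Data.Fin as Fin
open import Data.Fin.Properties using (toℕ<n; toℕ-fromℕ<; toℕ-injective)
open import Data.Fin.Permutation using (↔⇒≡)
open import Data.List using (List; []; _∷_; _++_; map; length; replicate; applyUpTo; upTo; allFin; tabulate)
open import Data.List.Properties
  using (map-++; map-cong; map-∘; map-tabulate; map-upTo; length-map; length-replicate; length-applyUpTo; length-++; ++-assoc; ++-identityʳ; map-replicate)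
open import Data.List.Membership.Propositional using (_∈_)
open import Data.List.Membership.Propositional.Properties using (∈-allFin; ∈-++⁻; ∈-++⁺ˡ; ∈-++⁺ʳ; ∈-map⁻; ∈-map⁺)
open import Data.List.Relation.Binary.Permutation.Propositional using (_↭_; ↭-trans; ↭-reflexive; ↭-refl; prep)
import Data.List.Relation.Binary.Permutation.Propositional.Properties as Perm
open import Data.List.Relation.Unary.All using (All; []; _∷_)
import Data.List.Relation.Unary.All as All
open import Data.List.Relation.Unary.All.Properties using (++⁺)
open import Data.List.Relation.Unary.Any using (here; there)
open import Data.Nat
open import Data.Nat.Properties
open import Data.Nat.Divisibility using (_∣_)
open import Data.Nat.DivMod using (m*[n/m]≡n)
open import Data.Nat.ListAction using (sum)
open import Data.Nat.ListAction.Properties using (sum-++; sum-↭)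
open import Data.Nat.Tactic.RingSolver using (solve-∀)
open import Data.Product hiding (map)
import Data.Product
open import Data.Sum using (_⊎_; inj₁; inj₂)
open import Data.Unit using (tt)
open import Function using (_∘_)
open import Function.Bundles using (Inverse; _↔_; Equivalence; _⇔_; mk⇔)
open import Function.Construct.Identity using (↔-id; ⇔-id)
open import Relation.Binary.Definitions using (tri<; tri≈; tri>)
open import Relation.Binary.PropositionalEquality
open import Relation.Nullary
import Algebra.Properties.CommutativeMonoid.Sum as CSum
open import Algebra.Properties.CommutativeSemigroup +-commutativeSemigroup using (interchange)

open Equivalence

-- Distance on a cycle

-- Positions on a g-cycle are 0 … g-1; position p is joined to p+1 and g-1 to 0.
cycleDist : ℕ → ℕ → ℕ → ℕ
cycleDist g p q = ∣ p - q ∣ ⊓ (g ∸ ∣ p - q ∣)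

⊓-lipschitz : ∀ {x x' y y'} → x ≤ suc x' → y ≤ suc y' → x ⊓ y ≤ suc (x' ⊓ y')
⊓-lipschitz {x} {x'} {y} {y'} x≤ y≤ with ⊓-sel x' y'
... | inj₁ eq rewrite eq = ≤-trans (m⊓n≤m x y) x≤
... | inj₂ eq rewrite eq = ≤-trans (m⊓n≤n x y) y≤

m∸n≤1+m∸1+n : ∀ m n → m ∸ n ≤ suc (m ∸ suc n)
m∸n≤1+m∸1+n zero    zero    = z≤n
m∸n≤1+m∸1+n zero    (suc n) = z≤n
m∸n≤1+m∸1+n (suc m) zero    = ≤-refl
m∸n≤1+m∸1+n (suc m) (suc n) = m∸n≤1+m∸1+n m n

d⊓[g∸d]-lipschitz : ∀ g {d d'} → d ≤ suc d' → d' ≤ suc d → d ⊓ (g ∸ d) ≤ suc (d' ⊓ (g ∸ d'))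
d⊓[g∸d]-lipschitz g {d} d≤ d'≤ = ⊓-lipschitz d≤ (≤-trans (m∸n≤1+m∸1+n g d) (s≤s (∸-monoʳ-≤ g d'≤)))

cycleDist-refl : ∀ g p → cycleDist g p p ≡ 0
cycleDist-refl g p rewrite ∣n-n∣≡0 p = refl

cycleDist-sym : ∀ g p q → cycleDist g p q ≡ cycleDist g q p
cycleDist-sym g p q rewrite ∣-∣-comm p q = refl

cycleDist≤g : ∀ g p q → cycleDist g p q ≤ g
cycleDist≤g g p q = ≤-trans (m⊓n≤n ∣ p - q ∣ _) (m∸n≤m g ∣ p - q ∣)

∣m-n∣<o : ∀ {m n o} → m < o → n < o → ∣ m - n ∣ < o
∣m-n∣<o {zero}  {n}     m<o n<o = n<o
∣m-n∣<o {suc m} {zero}  m<o n<o = m<o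
∣m-n∣<o {suc m} {suc n} {suc o} (s≤s m<o) (s≤s n<o) = <-trans (∣m-n∣<o m<o n<o) (n<1+n o)

cycleDist≡0⇒≡ : ∀ {g p q} → p < g → q < g → cycleDist g p q ≡ 0 → p ≡ q
cycleDist≡0⇒≡ {g} {p} {q} p<g q<g eq with ⊓-sel ∣ p - q ∣ (g ∸ ∣ p - q ∣)
... | inj₁ sel = ∣m-n∣≡0⇒m≡n (trans (sym sel) eq)
... | inj₂ sel = ⊥-elim (<⇒≱ (∣m-n∣<o p<g q<g) (m∸n≡0⇒m≤n (trans (sym sel) eq)))

∣n-1+n∣≡1 : ∀ n → ∣ n - suc n ∣ ≡ 1
∣n-1+n∣≡1 zero    = refl
∣n-1+n∣≡1 (suc n) = ∣n-1+n∣≡1 n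

∣m-n∣≤1+∣1+m-n∣ : ∀ m n → ∣ m - n ∣ ≤ suc ∣ suc m - n ∣
∣m-n∣≤1+∣1+m-n∣ m n = ≤-trans (∣-∣-triangle m (suc m) n) (≤-reflexive (cong (_+ ∣ suc m - n ∣) (∣n-1+n∣≡1 m)))

∣1+m-n∣≤1+∣m-n∣ : ∀ m n → ∣ suc m - n ∣ ≤ suc ∣ m - n ∣
∣1+m-n∣≤1+∣m-n∣ m n = ≤-trans (∣-∣-triangle (suc m) m n)
  (≤-reflexive (cong (_+ ∣ m - n ∣) (trans (∣-∣-comm (suc m) m) (∣n-1+n∣≡1 m))))

cycleDist-last : ∀ m r → r ≤ m → cycleDist (suc m) m r ≡ (m ∸ r) ⊓ suc r
cycleDist-last m r r≤m rewrite m≤n⇒∣n-m∣≡n∸m r≤m | +-∸-assoc 1 (m∸n≤m m r) | m∸[m∸n]≡n r≤m = refl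

cycleDist-first : ∀ m r → r ≤ m → cycleDist (suc m) 0 r ≡ r ⊓ suc (m ∸ r)
cycleDist-first m r r≤m rewrite +-∸-assoc 1 r≤m = refl

n≤2+n : ∀ n → n ≤ suc (suc n)
n≤2+n n = ≤-trans (n≤1+n n) (n≤1+n _)

cycleDist-last≤ : ∀ m r → r ≤ m → cycleDist (suc m) m r ≤ suc (cycleDist (suc m) 0 r)
cycleDist-last≤ m r r≤m rewrite cycleDist-last m r r≤m | cycleDist-first m r r≤m | ⊓-comm r (suc (m ∸ r)) =
  ⊓-lipschitz (n≤2+n _) ≤-refl

cycleDist-first≤ : ∀ m r → r ≤ m → cycleDist (suc m) 0 r ≤ suc (cycleDist (suc m) m r)
cycleDist-first≤ m r r≤m rewrite cycleDist-last m r r≤m | cycleDist-first m r r≤m | ⊓-comm (m ∸ r) (suc r) =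
  ⊓-lipschitz (n≤2+n _) ≤-refl

data Adjacent (g p : ℕ) : ℕ → Set where
  next      : suc p < g → Adjacent g p (suc p)
  prev      : ∀ {p'} → p ≡ suc p' → Adjacent g p p'
  next-wrap : suc p ≡ g → Adjacent g p 0
  prev-wrap : p ≡ 0 → Adjacent g p (g ∸ 1)

Adjacent-< : ∀ {g p p'} → Adjacent g p p' → p < g → p' < g
Adjacent-< (next 1+p<g)    p<g = 1+p<g
Adjacent-< (prev refl)     p<g = <-trans (n<1+n _) p<g
Adjacent-< (next-wrap _)   p<g = <-≤-trans (s≤s z≤n) p<g
Adjacent-< {suc g} (prev-wrap _) p<g = n<1+n g

cycleDist-Adjacent-lipschitz : ∀ {g p p' r} → Adjacent g p p' → p < g → r < g →
  cycleDist g p r ≤ suc (cycleDist g p' r) × cycleDist g p' r ≤ suc (cycleDist g p r)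
cycleDist-Adjacent-lipschitz {g} {p} {r = r} (next _) _ _ =
  d⊓[g∸d]-lipschitz g (∣m-n∣≤1+∣1+m-n∣ p r) (∣1+m-n∣≤1+∣m-n∣ p r) ,
  d⊓[g∸d]-lipschitz g (∣1+m-n∣≤1+∣m-n∣ p r) (∣m-n∣≤1+∣1+m-n∣ p r)
cycleDist-Adjacent-lipschitz {g} {r = r} (prev {p'} refl) _ _ =
  d⊓[g∸d]-lipschitz g (∣1+m-n∣≤1+∣m-n∣ p' r) (∣m-n∣≤1+∣1+m-n∣ p' r) ,
  d⊓[g∸d]-lipschitz g (∣m-n∣≤1+∣1+m-n∣ p' r) (∣1+m-n∣≤1+∣m-n∣ p' r)
cycleDist-Adjacent-lipschitz {suc g} {r = r} (next-wrap refl) _ (s≤s r≤g) = cycleDist-last≤ g r r≤g , cycleDist-first≤ g r r≤g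
cycleDist-Adjacent-lipschitz {suc g} {r = r} (prev-wrap refl) _ (s≤s r≤g) = cycleDist-first≤ g r r≤g , cycleDist-last≤ g r r≤g

<⇒∃+suc : ∀ {m n} → m < n → ∃ λ d → n ≡ m + suc d
<⇒∃+suc {zero}  {suc n} _ = n , refl
<⇒∃+suc {suc m} {suc n} (s≤s m<n) = map₂ (cong suc) (<⇒∃+suc m<n)

cycleDist-split : ∀ g p q {d s} → ∣ p - q ∣ ≡ d → g ≡ d + s → cycleDist g p q ≡ d ⊓ s
cycleDist-split g p q {d} {s} refl refl = cong (d ⊓_) (m+n∸m≡n d s)

∣m+n-m∣≡n : ∀ m n → ∣ m + n - m ∣ ≡ n
∣m+n-m∣≡n m n = trans (∣-∣-comm (m + n) m) (∣m-m+n∣≡n m n)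

-- With q = p + suc d and g = q + suc e, step from p towards q along the shorter arc:
-- forwards if that is the arc through p + 1, otherwise backwards (wrapping from 0 to g - 1).
cycleDist-descent-< : ∀ p d e → ∃ λ p' → Adjacent (p + suc d + suc e) p p' ×
  suc (cycleDist (p + suc d + suc e) p' (p + suc d)) ≡ cycleDist (p + suc d + suc e) p (p + suc d)
cycleDist-descent-< p d e with suc d ≤? p + suc e
... | yes short = suc p , next 2+p≤g , trans (cong suc after) (sym before)
  where
  g≡₁ : ∀ p d e → suc (suc (p + (d + e))) ≡ p + suc d + suc e
  g≡₁ = solve-∀
  g≡₂ : ∀ p d e → p + suc d + suc e ≡ d + suc (p + suc e)
  g≡₂ = solve-∀
  g≡₃ : ∀ p d e → p + suc d + suc e ≡ suc d + (p + suc e)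
  g≡₃ = solve-∀
  2+p≤g : suc (suc p) ≤ p + suc d + suc e
  2+p≤g = ≤-trans (s≤s (s≤s (m≤m+n p (d + e)))) (≤-reflexive (g≡₁ p d e))
  after : cycleDist (p + suc d + suc e) (suc p) (p + suc d) ≡ d
  after = trans (cycleDist-split _ (suc p) (p + suc d) (trans (cong (∣ suc p -_∣) (+-suc p d)) (∣m-m+n∣≡n (suc p) d)) (g≡₂ p d e))
                (m≤n⇒m⊓n≡m (≤-trans (n≤1+n d) (≤-trans short (n≤1+n _))))
  before : cycleDist (p + suc d + suc e) p (p + suc d) ≡ suc d
  before = trans (cycleDist-split _ p (p + suc d) (∣m-m+n∣≡n p (suc d)) (g≡₃ p d e)) (m≤n⇒m⊓n≡m short)
cycleDist-descent-< zero d e | no long = d + suc e , prev-wrap refl , trans (cong suc after) (sym before)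
  where
  g≡ : ∀ d e → suc d + suc e ≡ e + suc (suc d)
  g≡ = solve-∀
  after : cycleDist (suc d + suc e) (d + suc e) (suc d) ≡ e
  after = trans (cycleDist-split _ (d + suc e) (suc d) (trans (cong (∣_- suc d ∣) (+-suc d e)) (∣m+n-m∣≡n (suc d) e)) (g≡ d e))
                (m≤n⇒m⊓n≡m (≤-trans (n≤1+n e) (≤-trans (≰⇒≥ long) (n≤1+n _))))
  before : cycleDist (suc d + suc e) 0 (suc d) ≡ suc e
  before = trans (cycleDist-split _ 0 (suc d) refl refl) (m≥n⇒m⊓n≡n (≤-trans (n≤1+n _) (≰⇒> long)))
cycleDist-descent-< (suc p) d e | no long = p , prev refl , trans (cong suc after) (sym before)
  where
  g≡₁ : ∀ p d e → suc p + suc d + suc e ≡ suc (suc d) + (p + suc e)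
  g≡₁ = solve-∀
  g≡₂ : ∀ p d e → suc p + suc d + suc e ≡ suc d + suc (p + suc e)
  g≡₂ = solve-∀
  after : cycleDist (suc p + suc d + suc e) p (suc p + suc d) ≡ p + suc e
  after = trans (cycleDist-split _ p (suc p + suc d) (trans (cong (∣ p -_∣) (sym (+-suc p (suc d)))) (∣m-m+n∣≡n p (suc (suc d)))) (g≡₁ p d e))
                (m≥n⇒m⊓n≡n (≤-trans (≤-trans (n≤2+n _) (≰⇒> long)) (n≤1+n _)))
  before : cycleDist (suc p + suc d + suc e) (suc p) (suc p + suc d) ≡ suc (p + suc e)
  before = trans (cycleDist-split _ (suc p) (suc p + suc d) (∣m-m+n∣≡n (suc p) (suc d)) (g≡₂ p d e))
                 (m≥n⇒m⊓n≡n (≤-trans (n≤1+n _) (≰⇒> long)))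

cycleDist-descent-> : ∀ q d e → ∃ λ p' → Adjacent (q + suc d + suc e) (q + suc d) p' ×
  suc (cycleDist (q + suc d + suc e) p' q) ≡ cycleDist (q + suc d + suc e) (q + suc d) q
cycleDist-descent-> q d e with suc d ≤? q + suc e
... | yes short = q + d , prev (+-suc q d) , trans (cong suc after) (sym before)
  where
  g≡₁ : ∀ q d e → q + suc d + suc e ≡ d + suc (q + suc e)
  g≡₁ = solve-∀
  g≡₂ : ∀ q d e → q + suc d + suc e ≡ suc d + (q + suc e)
  g≡₂ = solve-∀
  after : cycleDist (q + suc d + suc e) (q + d) q ≡ d
  after = trans (cycleDist-split _ (q + d) q (∣m+n-m∣≡n q d) (g≡₁ q d e))
                (m≤n⇒m⊓n≡m (≤-trans (n≤1+n d) (≤-trans short (n≤1+n _))))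
  before : cycleDist (q + suc d + suc e) (q + suc d) q ≡ suc d
  before = trans (cycleDist-split _ (q + suc d) q (∣m+n-m∣≡n q (suc d)) (g≡₂ q d e)) (m≤n⇒m⊓n≡m short)
cycleDist-descent-> q d (suc e) | no long = suc (q + suc d) , next 2+p≤g , trans (cong suc after) (sym before)
  where
  g≡₁ : ∀ q d e → suc (suc (q + suc d + e)) ≡ q + suc d + suc (suc e)
  g≡₁ = solve-∀
  g≡₂ : ∀ q d e → q + suc d + suc (suc e) ≡ suc (suc d) + (q + suc e)
  g≡₂ = solve-∀
  g≡₃ : ∀ q d e → q + suc d + suc (suc e) ≡ suc d + (q + suc (suc e))
  g≡₃ = solve-∀
  2+p≤g : suc (suc (q + suc d)) ≤ q + suc d + suc (suc e)
  2+p≤g = ≤-trans (s≤s (s≤s (m≤m+n (q + suc d) e))) (≤-reflexive (g≡₁ q d e))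
  after : cycleDist (q + suc d + suc (suc e)) (suc (q + suc d)) q ≡ q + suc e
  after = trans (cycleDist-split _ (suc (q + suc d)) q (trans (cong (∣_- q ∣) (sym (+-suc q (suc d)))) (∣m+n-m∣≡n q (suc (suc d)))) (g≡₂ q d e))
                (m≥n⇒m⊓n≡n (≤-trans (+-monoʳ-≤ q (n≤1+n (suc e))) (≤-trans (n≤1+n _) (≤-trans (≰⇒> long) (n≤1+n _)))))
  before : cycleDist (q + suc d + suc (suc e)) (q + suc d) q ≡ suc (q + suc e)
  before = trans (cycleDist-split _ (q + suc d) q (∣m+n-m∣≡n q (suc d)) (g≡₃ q d e))
                 (trans (m≥n⇒m⊓n≡n (≤-trans (n≤1+n _) (≰⇒> long))) (+-suc q (suc e)))
cycleDist-descent-> q d zero | no long = 0 , next-wrap (g≡₁ q d) , trans (cong suc after) (sym before)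
  where
  g≡₁ : ∀ q d → suc (q + suc d) ≡ q + suc d + 1
  g≡₁ = solve-∀
  g≡₂ : ∀ q d → q + suc d + 1 ≡ q + suc (suc d)
  g≡₂ = solve-∀
  g≡₃ : ∀ q d → q + suc d + 1 ≡ suc d + (q + 1)
  g≡₃ = solve-∀
  after : cycleDist (q + suc d + 1) 0 q ≡ q
  after = trans (cycleDist-split _ 0 q refl (g≡₂ q d))
                (m≤n⇒m⊓n≡m (≤-trans (n≤1+n q) (≤-trans (≤-reflexive (+-comm 1 q)) (≤-trans (n≤1+n _) (≤-trans (≰⇒> long) (n≤1+n _))))))
  before : cycleDist (q + suc d + 1) (q + suc d) q ≡ suc q
  before = trans (cycleDist-split _ (q + suc d) q (∣m+n-m∣≡n q (suc d)) (g≡₃ q d))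
                 (trans (m≥n⇒m⊓n≡n (≤-trans (n≤1+n _) (≰⇒> long))) (+-comm q 1))

cycleDist-descent : ∀ g p q → p < g → q < g → p ≢ q → ∃ λ p' → Adjacent g p p' × suc (cycleDist g p' q) ≡ cycleDist g p q
cycleDist-descent g p q p<g q<g p≢q with <-cmp p q
... | tri≈ _ p≡q _ = ⊥-elim (p≢q p≡q)
... | tri< p<q _ _ with <⇒∃+suc p<q | <⇒∃+suc q<g
...   | d , refl | e , refl = cycleDist-descent-< p d e
cycleDist-descent g p q p<g q<g p≢q | tri> _ _ q<p with <⇒∃+suc q<p | <⇒∃+suc p<g
...   | d , refl | e , refl = cycleDist-descent-> q d e

cycleDist-triangle : ∀ g p q r → p < g → q < g → r < g → cycleDist g p r ≤ cycleDist g p q + cycleDist g q r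
cycleDist-triangle g p q r p<g q<g r<g = go (cycleDist g p q) p refl p<g
  where
  go : ∀ k p → cycleDist g p q ≡ k → p < g → cycleDist g p r ≤ cycleDist g p q + cycleDist g q r
  go zero p eq p<g with cycleDist≡0⇒≡ p<g q<g eq
  ... | refl rewrite eq = ≤-refl
  go (suc k) p eq p<g with p ≟ q
  ... | yes refl rewrite cycleDist-refl g p = ≤-refl
  ... | no p≢q with cycleDist-descent g p q p<g q<g p≢q
  ...   | p' , adj , descends = begin
    cycleDist g p r                          ≤⟨ proj₁ (cycleDist-Adjacent-lipschitz adj p<g r<g) ⟩
    suc (cycleDist g p' r)                   ≤⟨ s≤s (go k p' (suc-injective (trans descends eq)) (Adjacent-< adj p<g)) ⟩
    suc (cycleDist g p' q + cycleDist g q r) ≡⟨ cong (_+ cycleDist g q r) descends ⟩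
    cycleDist g p q + cycleDist g q r        ∎
    where open ≤-Reasoning

-- Descriptors of vertices

-- A vertex of U(T₁,…,T_g) with every Tₚ of depth ≤ 2 is described by (p , h , i): it lies in
-- Tₚ at depth h, in the branch of the i-th child of the root (i = 0 for the root itself).
Descriptor : Set
Descriptor = ℕ × ℕ × ℕ

descDist : ℕ → Descriptor → Descriptor → ℕ
descDist g (p , h , i) (q , k , j) with p ≟ q | i ≟ j
... | yes _ | yes _ = ∣ h - k ∣
... | yes _ | no _ = h + k
... | no _ | _ = h + k + cycleDist g p q

descDist-refl : ∀ g x → descDist g x x ≡ 0
descDist-refl g (p , h , i) with p ≟ p | i ≟ i
... | yes _ | yes _ = ∣n-n∣≡0 h
... | yes _ | no n = ⊥-elim (n refl)
... | no n | _ = ⊥-elim (n refl)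

descDist-sym : ∀ g x y → descDist g x y ≡ descDist g y x
descDist-sym g (p , h , i) (q , k , j) with p ≟ q | i ≟ j | q ≟ p | j ≟ i
... | yes _ | yes _ | yes _ | yes _ = ∣-∣-comm h k
... | yes _ | yes e | _ | no n = ⊥-elim (n (sym e))
... | yes e | _ | no n | _ = ⊥-elim (n (sym e))
... | yes _ | no n | _ | yes e = ⊥-elim (n (sym e))
... | yes _ | no _ | yes _ | no _ = +-comm h k
... | no n | _ | yes e | _ = ⊥-elim (n (sym e))
... | no _ | _ | no _ | _ = cong₂ _+_ (+-comm h k) (cycleDist-sym g p q)

Lipschitz : ℕ → Descriptor → Descriptor → Descriptor → Set
Lipschitz g x y z = descDist g x z ≤ suc (descDist g y z) × descDist g y z ≤ suc (descDist g x z)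

n≤1+∣1-n∣ : ∀ n → n ≤ suc ∣ 1 - n ∣
n≤1+∣1-n∣ zero    = z≤n
n≤1+∣1-n∣ (suc n) = ≤-refl

∣1-n∣≤1+n : ∀ n → ∣ 1 - n ∣ ≤ suc n
∣1-n∣≤1+n zero    = s≤s z≤n
∣1-n∣≤1+n (suc n) = n≤2+n n

Lipschitz-treeEdge : ∀ g p h i i' z → (h ≡ 0 × i' ≡ 0) ⊎ i' ≡ i → Lipschitz g (p , h , i') (p , suc h , i) z
Lipschitz-treeEdge g p h i i' (q , k , j) c with p ≟ q | i' ≟ j | i ≟ j
... | no _ | _ | _ = n≤2+n _ , ≤-refl
... | yes _ | yes _ | yes _ = ∣m-n∣≤1+∣1+m-n∣ h k , ∣1+m-n∣≤1+∣m-n∣ h k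
... | yes _ | no _ | no _ = n≤2+n _ , ≤-refl
... | yes _ | yes e1 | no n with c
...   | inj₂ e2 = ⊥-elim (n (trans (sym e2) e1))
...   | inj₁ (refl , refl) = n≤2+n k , ≤-refl
Lipschitz-treeEdge g p h i i' (q , k , j) c | yes _ | no n | yes e1 with c
...   | inj₂ e2 = ⊥-elim (n (trans e2 e1))
...   | inj₁ (refl , refl) = n≤1+∣1-n∣ k , ∣1-n∣≤1+n k

descDist-root-same : ∀ g p k j → descDist g (p , 0 , 0) (p , k , j) ≡ k
descDist-root-same g p k j with p ≟ p | 0 ≟ j
... | yes _ | yes _ = refl
... | yes _ | no _ = refl
... | no n | _ = ⊥-elim (n refl)

descDist-≢ : ∀ g p h i q k j → p ≢ q → descDist g (p , h , i) (q , k , j) ≡ h + k + cycleDist g p q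
descDist-≢ g p h i q k j ne with p ≟ q
... | yes e = ⊥-elim (ne e)
... | no _ = refl

descDist-same-branch : ∀ g p h i k → descDist g (p , h , i) (p , k , i) ≡ ∣ h - k ∣
descDist-same-branch g p h i k with p ≟ p | i ≟ i
... | yes _ | yes _ = refl
... | yes _ | no n = ⊥-elim (n refl)
... | no n | _ = ⊥-elim (n refl)

descDist-other-branch : ∀ g p h i k j → i ≢ j → descDist g (p , h , i) (p , k , j) ≡ h + k
descDist-other-branch g p h i k j ne with p ≟ p | i ≟ j
... | yes _ | yes e = ⊥-elim (ne e)
... | yes _ | no _ = refl
... | no n | _ = ⊥-elim (n refl)

Lipschitz-cycleEdge′ : ∀ g p p' q k j → Adjacent g p p' → p < g → q < g → Dec (p ≡ q) → Dec (p' ≡ q) →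
  Lipschitz g (p , 0 , 0) (p' , 0 , 0) (q , k , j)
Lipschitz-cycleEdge′ g p p' q k j adj p<g q<g (yes refl) (yes refl) = n≤1+n _ , n≤1+n _
Lipschitz-cycleEdge′ g p p' q k j adj p<g q<g (yes refl) (no p'≢p)
  rewrite descDist-root-same g p k j | descDist-≢ g p' 0 0 p k j p'≢p =
    ≤-trans (m≤m+n k _) (n≤1+n _) , ≤-trans (≤-reflexive (+-comm k _)) (+-monoˡ-≤ k p'p≤1)
  where
  p'p≤1 : cycleDist g p' p ≤ 1
  p'p≤1 = ≤-trans (proj₂ (cycleDist-Adjacent-lipschitz adj p<g p<g)) (≤-reflexive (cong suc (cycleDist-refl g p)))
Lipschitz-cycleEdge′ g p p' q k j adj p<g q<g (no p≢p') (yes refl)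
  rewrite descDist-root-same g p' k j | descDist-≢ g p 0 0 p' k j p≢p' =
    ≤-trans (≤-reflexive (+-comm k _)) (+-monoˡ-≤ k pp'≤1) , ≤-trans (m≤m+n k _) (n≤1+n _)
  where
  pp'≤1 : cycleDist g p p' ≤ 1
  pp'≤1 = ≤-trans (proj₁ (cycleDist-Adjacent-lipschitz adj p<g (Adjacent-< adj p<g))) (≤-reflexive (cong suc (cycleDist-refl g p')))
Lipschitz-cycleEdge′ g p p' q k j adj p<g q<g (no p≢q) (no p'≢q)
  rewrite descDist-≢ g p 0 0 q k j p≢q | descDist-≢ g p' 0 0 q k j p'≢q =
    Data.Product.map k+-lipschitz k+-lipschitz (cycleDist-Adjacent-lipschitz adj p<g q<g)
  where
  k+-lipschitz : ∀ {c c'} → c ≤ suc c' → k + c ≤ suc (k + c')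
  k+-lipschitz {c' = c'} c≤ = ≤-trans (+-monoʳ-≤ k c≤) (≤-reflexive (+-suc k c'))

Lipschitz-cycleEdge : ∀ g p p' z → Adjacent g p p' → p < g → proj₁ z < g → Lipschitz g (p , 0 , 0) (p' , 0 , 0) z
Lipschitz-cycleEdge g p p' (q , k , j) adj p<g q<g = Lipschitz-cycleEdge′ g p p' q k j adj p<g q<g (p ≟ q) (p' ≟ q)

descDist≤ : ∀ g p h i q k j → descDist g (p , h , i) (q , k , j) ≤ h + k + cycleDist g p q
descDist≤ g p h i q k j with p ≟ q | i ≟ j
... | yes _ | yes _ = ≤-trans (≤-trans (∣m-n∣≤m⊔n h k) (m⊔n≤m+n h k)) (m≤m+n _ _)
... | yes _ | no _ = m≤m+n _ _
... | no _ | _ = ≤-refl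

-- Recognising the graph distance

EdgeIn : Graph → ℕ → ℕ → Set
EdgeIn G x y = (x , y) ∈ edges G ⊎ (y , x) ∈ edges G

any⇒∃ : ∀ {A : Set} (f : A → Bool) xs → T (any f xs) → ∃ λ x → x ∈ xs × T (f x)
any⇒∃ f (x ∷ xs) t with to T-∨ t
... | inj₁ a = x , here refl , a
... | inj₂ b with any⇒∃ f xs b
...   | y , m , c = y , there m , c

∈∧T⇒any : ∀ {A : Set} (f : A → Bool) {xs x} → x ∈ xs → T (f x) → T (any f xs)
∈∧T⇒any f (here refl) t = from T-∨ (inj₁ t)
∈∧T⇒any f (there m) t = from T-∨ (inj₂ (∈∧T⇒any f m t))

module _ (G : Graph) where
  endpointsMatch : Fin (n G) → Fin (n G) → ℕ × ℕ → Bool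
  endpointsMatch u v = λ { (x , y) → ((toℕ u ≡ᵇ x) ∧ (toℕ v ≡ᵇ y)) ∨ ((toℕ u ≡ᵇ y) ∧ (toℕ v ≡ᵇ x)) }

  adjb⇒EdgeIn : ∀ u v → T (adjb G u v) → EdgeIn G (toℕ u) (toℕ v)
  adjb⇒EdgeIn u v t with any⇒∃ (endpointsMatch u v) (edges G) t
  ... | (x , y) , m , c with to (T-∨ {(toℕ u ≡ᵇ x) ∧ (toℕ v ≡ᵇ y)} {(toℕ u ≡ᵇ y) ∧ (toℕ v ≡ᵇ x)}) c
  ...   | inj₁ a with to (T-∧ {toℕ u ≡ᵇ x} {toℕ v ≡ᵇ y}) a
  ...     | a1 , a2 = subst₂ (EdgeIn G) (sym (≡ᵇ⇒≡ _ _ a1)) (sym (≡ᵇ⇒≡ _ _ a2)) (inj₁ m)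
  adjb⇒EdgeIn u v t | (x , y) , m , c | inj₂ a with to (T-∧ {toℕ u ≡ᵇ y} {toℕ v ≡ᵇ x}) a
  ...     | a1 , a2 = subst₂ (EdgeIn G) (sym (≡ᵇ⇒≡ _ _ a1)) (sym (≡ᵇ⇒≡ _ _ a2)) (inj₂ m)

  EdgeIn⇒adjb : ∀ u v → EdgeIn G (toℕ u) (toℕ v) → T (adjb G u v)
  EdgeIn⇒adjb u v (inj₁ m) = ∈∧T⇒any (endpointsMatch u v) m
     (from (T-∨ {(toℕ u ≡ᵇ toℕ u) ∧ (toℕ v ≡ᵇ toℕ v)} {(toℕ u ≡ᵇ toℕ v) ∧ (toℕ v ≡ᵇ toℕ u)})
       (inj₁ (from (T-∧ {toℕ u ≡ᵇ toℕ u} {toℕ v ≡ᵇ toℕ v}) (≡⇒≡ᵇ (toℕ u) (toℕ u) refl , ≡⇒≡ᵇ (toℕ v) (toℕ v) refl))))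
  EdgeIn⇒adjb u v (inj₂ m) = ∈∧T⇒any (endpointsMatch u v) m
     (from (T-∨ {(toℕ u ≡ᵇ toℕ v) ∧ (toℕ v ≡ᵇ toℕ u)} {(toℕ u ≡ᵇ toℕ u) ∧ (toℕ v ≡ᵇ toℕ v)})
       (inj₂ (from (T-∧ {toℕ u ≡ᵇ toℕ u} {toℕ v ≡ᵇ toℕ v}) (≡⇒≡ᵇ (toℕ u) (toℕ u) refl , ≡⇒≡ᵇ (toℕ v) (toℕ v) refl))))

-- A function on vertex indices that changes by at most 1 along edges, vanishes on the diagonal
-- and can always be decreased by 1 along some edge is the graph distance: the first property
-- gives dist ≥ δ and the descent gives dist ≤ δ.  The bound is needed only because dist
-- searches walks of length up to n.
record DistanceCertificate (G : Graph) (δ : ℕ → ℕ → ℕ) : Set where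
  field
    lipschitz : ∀ x y z → (x , y) ∈ edges G → z < n G → δ x z ≤ suc (δ y z) × δ y z ≤ suc (δ x z)
    diagonal : ∀ x → x < n G → δ x x ≡ 0
    descent : ∀ x z → x < n G → z < n G → x ≢ z → Σ ℕ λ y → y < n G × EdgeIn G x y × suc (δ y z) ≡ δ x z
    bounded : ∀ x z → x < n G → z < n G → δ x z ≤ n G

module Certified {G : Graph} {δ : ℕ → ℕ → ℕ} (C : DistanceCertificate G δ) where
  open DistanceCertificate C

  reach⇒δ≤ : ∀ k u v → T (reach G k u v) → δ (toℕ u) (toℕ v) ≤ k
  reach⇒δ≤ zero u v t = ≤-reflexive (trans (cong (λ a → δ a (toℕ v)) (≡ᵇ⇒≡ (toℕ u) (toℕ v) t)) (diagonal (toℕ v) (toℕ<n v)))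
  reach⇒δ≤ (suc k) u v t with to T-∨ t
  ... | inj₁ a = ≤-trans (reach⇒δ≤ k u v a) (n≤1+n k)
  ... | inj₂ b with any⇒∃ (λ w → adjb G u w ∧ reach G k w v) (allFin (n G)) b
  ...   | w , _ , c with to T-∧ c
  ...     | c1 , c2 with adjb⇒EdgeIn G u w c1
  ...       | inj₁ m = ≤-trans (proj₁ (lipschitz _ _ _ m (toℕ<n v))) (s≤s (reach⇒δ≤ k w v c2))
  ...       | inj₂ m = ≤-trans (proj₂ (lipschitz _ _ _ m (toℕ<n v))) (s≤s (reach⇒δ≤ k w v c2))

  δ≡0⇒≡ : ∀ x z → x < n G → z < n G → δ x z ≡ 0 → x ≡ z
  δ≡0⇒≡ x z xn zn e with x ≟ z
  ... | yes p = p
  ... | no ne with descent x z xn zn ne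
  ...   | y , _ , _ , s = ⊥-elim (1+n≢0 (trans s e))

  δ≤⇒reach : ∀ k u v → δ (toℕ u) (toℕ v) ≤ k → T (reach G k u v)
  δ≤⇒reach zero u v h = ≡⇒≡ᵇ _ _ (δ≡0⇒≡ _ _ (toℕ<n u) (toℕ<n v) (n≤0⇒n≡0 h))
  δ≤⇒reach (suc k) u v h with δ (toℕ u) (toℕ v) ≤? k
  ... | yes h' = from T-∨ (inj₁ (δ≤⇒reach k u v h'))
  ... | no h' with toℕ u ≟ toℕ v
  ...   | yes e = ⊥-elim (h' (≤-trans (≤-reflexive (trans (cong (δ (toℕ u)) (sym e)) (diagonal _ (toℕ<n u)))) z≤n))
  ...   | no ne with descent _ _ (toℕ<n u) (toℕ<n v) ne
  ...     | y , yn , ed , s = from T-∨ (inj₂ (∈∧T⇒any (λ w → adjb G u w ∧ reach G k w v) (∈-allFin w)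
               (from T-∧ (EdgeIn⇒adjb G u w ed' , δ≤⇒reach k w v dk))))
    where
    w : Fin (n G)
    w = fromℕ< yn
    tw : toℕ w ≡ y
    tw = toℕ-fromℕ< yn
    ed' : EdgeIn G (toℕ u) (toℕ w)
    ed' rewrite tw = ed
    dk : δ (toℕ w) (toℕ v) ≤ k
    dk rewrite tw = s≤s⁻¹ (≤-trans (≤-reflexive s) h)

  distSearch≡δ : ∀ u v f k → k + f ≡ n G → k ≤ δ (toℕ u) (toℕ v) → distSearch G u v k f ≡ δ (toℕ u) (toℕ v)
  distSearch≡δ u v zero k e h rewrite +-identityʳ k = ≤-antisym h (≤-trans (bounded _ _ (toℕ<n u) (toℕ<n v)) (≤-reflexive (sym e)))
  distSearch≡δ u v (suc f) k e h with reach G k u v in eq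
  ... | true = ≤-antisym h (reach⇒δ≤ k u v (subst T (sym eq) tt))
  ... | false = distSearch≡δ u v f (suc k) (trans (sym (+-suc k f)) e) (≰⇒> λ h' → subst T eq (δ≤⇒reach k u v h'))

  dist≡δ : ∀ u v → dist G u v ≡ δ (toℕ u) (toℕ v)
  dist≡δ u v = distSearch≡δ u v (n G) 0 refl z≤n

sum-map-+ : ∀ {A : Set} (f h : A → ℕ) xs → sum (map (λ x → f x + h x) xs) ≡ sum (map f xs) + sum (map h xs)
sum-map-+ f h [] = refl
sum-map-+ f h (x ∷ xs) rewrite sum-map-+ f h xs = interchange (f x) (h x) _ _

sum-map-cong : ∀ {A : Set} {f h : A → ℕ} xs → (∀ x → f x ≡ h x) → sum (map f xs) ≡ sum (map h xs)
sum-map-cong xs e = cong sum (map-cong e xs)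

sum-map-mono : ∀ {A : Set} {f h : A → ℕ} xs → All (λ x → f x ≤ h x) xs → sum (map f xs) ≤ sum (map h xs)
sum-map-mono [] [] = ≤-refl
sum-map-mono (x ∷ xs) (p ∷ ps) = +-mono-≤ p (sum-map-mono xs ps)

sum-map-congᴬ : ∀ {A : Set} {f h : A → ℕ} xs → All (λ x → f x ≡ h x) xs → sum (map f xs) ≡ sum (map h xs)
sum-map-congᴬ [] [] = refl
sum-map-congᴬ (x ∷ xs) (p ∷ ps) = cong₂ _+_ p (sum-map-congᴬ xs ps)

sum-map-const : ∀ {A : Set} (c : ℕ) (xs : List A) → sum (map (λ _ → c) xs) ≡ length xs * c
sum-map-const c [] = refl
sum-map-const c (x ∷ xs) = cong (c +_) (sum-map-const c xs)

sum-map-swap : ∀ {A B : Set} (h : A → B → ℕ) xs ys →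
  sum (map (λ x → sum (map (h x) ys)) xs) ≡ sum (map (λ y → sum (map (λ x → h x y) xs)) ys)
sum-map-swap h [] ys = sym (trans (sum-map-cong ys (λ _ → refl)) (trans (sum-map-const 0 ys) (*-zeroʳ (length ys))))
sum-map-swap h (x ∷ xs) ys = trans (cong (sum (map (h x) ys) +_) (sum-map-swap h xs ys)) (sym (sum-map-+ (h x) (λ y → sum (map (λ x → h x y) xs)) ys))

sum-map-++ : ∀ {A : Set} (f : A → ℕ) xs ys → sum (map f (xs ++ ys)) ≡ sum (map f xs) + sum (map f ys)
sum-map-++ f xs ys = trans (cong sum (map-++ f xs ys)) (sum-++ (map f xs) (map f ys))

sum-map-↭ : ∀ {A : Set} (f : A → ℕ) {xs ys} → xs ↭ ys → sum (map f xs) ≡ sum (map f ys)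
sum-map-↭ f p = sum-↭ (Perm.map⁺ f p)

tabulate-toℕ : ∀ {A : Set} n (f : ℕ → A) → tabulate {n = n} (f ∘ toℕ) ≡ applyUpTo f n
tabulate-toℕ zero f = refl
tabulate-toℕ (suc n) f = cong (f 0 ∷_) (tabulate-toℕ n (f ∘ suc))

map-allFin-toℕ : ∀ {A : Set} n (f : ℕ → A) → map (f ∘ toℕ) (allFin n) ≡ map f (upTo n)
map-allFin-toℕ n f = trans (map-tabulate (λ i → i) (f ∘ toℕ)) (trans (tabulate-toℕ n f) (sym (map-upTo f n)))

applyUpTo-+ : ∀ {A : Set} (f : ℕ → A) m k → applyUpTo f (m + k) ≡ applyUpTo f m ++ applyUpTo (λ i → f (m + i)) k
applyUpTo-+ f zero k = refl
applyUpTo-+ f (suc m) k = cong (f 0 ∷_) (applyUpTo-+ (f ∘ suc) m k)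

applyUpTo-cong : ∀ {A : Set} (f h : ℕ → A) k → (∀ i → i < k → f i ≡ h i) → applyUpTo f k ≡ applyUpTo h k
applyUpTo-cong f h zero e = refl
applyUpTo-cong f h (suc k) e = cong₂ _∷_ (e 0 (s≤s z≤n)) (applyUpTo-cong (f ∘ suc) (h ∘ suc) k (λ i lt → e (suc i) (s≤s lt)))

All-applyUpTo : ∀ {A : Set} {P : A → Set} (f : ℕ → A) k → (∀ i → i < k → P (f i)) → All P (applyUpTo f k)
All-applyUpTo f zero h = []
All-applyUpTo f (suc k) h = h 0 (s≤s z≤n) ∷ All-applyUpTo (f ∘ suc) k (λ i lt → h (suc i) (s≤s lt))

tstar : ℕ × ℕ → RTree
tstar (a , b) = Tstar a b

order : ℕ × ℕ → ℕ
order (a , b) = a + a + b + 1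

localDesc : ℕ × ℕ → ℕ → ℕ × ℕ
localDesc (a , b) l with l ≟ 0 | l ≤? a + b
... | yes _ | _ = 0 , 0
... | no _ | yes _ = 1 , l
... | no _ | no _ = 2 , l ∸ (a + b)

data TstarVertex (a b : ℕ) : ℕ → Set where
  root : TstarVertex a b 0
  leaf : ∀ i → 1 ≤ i → i ≤ a + b → TstarVertex a b i
  pendant : ∀ i → 1 ≤ i → i ≤ a → TstarVertex a b (a + b + i)

order-suc : ∀ a b → a + a + b + 1 ≡ suc (a + b + a)
order-suc = solve-∀

tstarVertex : ∀ a b l → l < order (a , b) → TstarVertex a b l
tstarVertex a b zero h = root
tstarVertex a b (suc l) h with suc l ≤? a + b
... | yes h' = leaf (suc l) (s≤s z≤n) h'
... | no h' = subst (TstarVertex a b) eq (pendant (suc l ∸ (a + b)) (m<n⇒0<n∸m (≰⇒> h')) le)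
  where
  eq : a + b + (suc l ∸ (a + b)) ≡ suc l
  eq = m+[n∸m]≡n (<⇒≤ (≰⇒> h'))
  le : suc l ∸ (a + b) ≤ a
  le = ≤-trans (∸-monoˡ-≤ (a + b) (s≤s⁻¹ (≤-trans h (≤-reflexive (order-suc a b))))) (≤-reflexive (m+n∸m≡n (a + b) a))

localDesc-leaf : ∀ a b i → 1 ≤ i → i ≤ a + b → localDesc (a , b) i ≡ (1 , i)
localDesc-leaf a b i h1 h2 with i ≟ 0 | i ≤? a + b
... | yes refl | _ = ⊥-elim (1+n≰n h1)
... | no _ | yes _ = refl
... | no _ | no n = ⊥-elim (n h2)

localDesc-pendant : ∀ a b i → 1 ≤ i → i ≤ a → localDesc (a , b) (a + b + i) ≡ (2 , i)
localDesc-pendant a b i h1 h2 with a + b + i ≟ 0 | a + b + i ≤? a + b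
... | yes e | _ = ⊥-elim (1+n≰n (≤-trans (≤-trans h1 (m≤n+m i (a + b))) (≤-reflexive e)))
... | no _ | yes h = ⊥-elim (1+n≰n (≤-trans (≤-trans (≤-reflexive (sym (+-suc (a + b) 0))) (+-monoʳ-≤ (a + b) h1)) (≤-trans h (≤-reflexive (sym (+-identityʳ (a + b)))))))
... | no _ | no _ = cong (2 ,_) (m+n∸m≡n (a + b) i)

range1⁻ : ∀ k {i} → i ∈ range1 k → 1 ≤ i × i ≤ k
range1⁻ (suc k) m with ∈-++⁻ (range1 k) m
... | inj₁ m' = proj₁ (range1⁻ k m') , ≤-trans (proj₂ (range1⁻ k m')) (n≤1+n k)
... | inj₂ (here refl) = s≤s z≤n , ≤-refl

range1⁺ : ∀ k {i} → 1 ≤ i → i ≤ k → i ∈ range1 k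
range1⁺ zero {zero} () _
range1⁺ (suc k) {i} h1 h2 with i ≟ suc k
... | yes refl = ∈-++⁺ʳ (range1 k) (here refl)
... | no ne = ∈-++⁺ˡ (range1⁺ k h1 (s≤s⁻¹ (≤∧≢⇒< h2 ne)))

data TstarEdge (a b : ℕ) : ℕ → ℕ → Set where
  leaf-edge : ∀ i → 1 ≤ i → i ≤ a + b → TstarEdge a b 0 i
  pendant-edge : ∀ i → 1 ≤ i → i ≤ a → TstarEdge a b i (a + b + i)

∈-tedges⁻ : ∀ a b {x y} → (x , y) ∈ tedges (Tstar a b) → TstarEdge a b x y
∈-tedges⁻ a b m with ∈-++⁻ (map (λ i → (0 , i)) (range1 (a + b))) m
... | inj₁ m' with ∈-map⁻ (λ i → (0 , i)) m'
...   | i , mi , refl = leaf-edge i (proj₁ (range1⁻ (a + b) mi)) (proj₂ (range1⁻ (a + b) mi))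
∈-tedges⁻ a b m | inj₂ m' with ∈-map⁻ (λ i → (i , a + b + i)) m'
...   | i , mi , refl = pendant-edge i (proj₁ (range1⁻ a mi)) (proj₂ (range1⁻ a mi))

∈-tedges⁺ : ∀ a b {x y} → TstarEdge a b x y → (x , y) ∈ tedges (Tstar a b)
∈-tedges⁺ a b (leaf-edge i h1 h2) = ∈-++⁺ˡ (∈-map⁺ (λ i → (0 , i)) (range1⁺ (a + b) h1 h2))
∈-tedges⁺ a b (pendant-edge i h1 h2) = ∈-++⁺ʳ (map (λ i → (0 , i)) (range1 (a + b))) (∈-map⁺ (λ i → (i , a + b + i)) (range1⁺ a h1 h2))

leaf<order : ∀ a b i → i ≤ a + b → i < order (a , b)
leaf<order a b i h = ≤-trans (s≤s (≤-trans h (m≤m+n (a + b) a))) (≤-reflexive (sym (order-suc a b)))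

pendant<order : ∀ a b i → i ≤ a → a + b + i < order (a , b)
pendant<order a b i h = ≤-trans (s≤s (+-monoʳ-≤ (a + b) h)) (≤-reflexive (sym (order-suc a b)))

vertexCount : List (ℕ × ℕ) → ℕ
vertexCount [] = 0
vertexCount (q ∷ ps) = order q + vertexCount ps

offset : List (ℕ × ℕ) → ℕ → ℕ
offset ps zero = 0
offset [] (suc p) = 0
offset (q ∷ ps) (suc p) = order q + offset ps p

treeAt : List (ℕ × ℕ) → ℕ → ℕ × ℕ
treeAt [] _ = (0 , 0)
treeAt (q ∷ ps) zero = q
treeAt (q ∷ ps) (suc p) = treeAt ps p

descriptor : ℕ → List (ℕ × ℕ) → ℕ → Descriptor
descriptor s [] x = (s , 0 , 0)
descriptor s (q ∷ ps) x with x <? order q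
... | yes _ = (s , localDesc q x)
... | no _ = descriptor (suc s) ps (x ∸ order q)

descriptor-here : ∀ s q ps x → x < order q → descriptor s (q ∷ ps) x ≡ (s , localDesc q x)
descriptor-here s q ps x h with x <? order q
... | yes _ = refl
... | no n = ⊥-elim (n h)

descriptor-there : ∀ s q ps x → descriptor s (q ∷ ps) (order q + x) ≡ descriptor (suc s) ps x
descriptor-there s q ps x with order q + x <? order q
... | yes h = ⊥-elim (<⇒≱ h (m≤m+n (order q) x))
... | no _ = cong (descriptor (suc s) ps) (m+n∸m≡n (order q) x)

descriptor-offset : ∀ s ps p l → p < length ps → l < order (treeAt ps p) → descriptor s ps (offset ps p + l) ≡ (s + p , localDesc (treeAt ps p) l)
descriptor-offset s (q ∷ ps) zero l _ h rewrite +-identityʳ s = descriptor-here s q ps l h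
descriptor-offset s (q ∷ ps) (suc p) l (s≤s p<len) h =
  trans (cong (descriptor s (q ∷ ps)) (+-assoc (order q) (offset ps p) l))
  (trans (descriptor-there s q ps (offset ps p + l)) (trans (descriptor-offset (suc s) ps p l p<len h) (cong (_, localDesc (treeAt ps p) l) (sym (+-suc s p)))))

locate : ∀ ps x → x < vertexCount ps → Σ ℕ λ p → Σ ℕ λ l → p < length ps × l < order (treeAt ps p) × x ≡ offset ps p + l
locate (q ∷ ps) x h with x <? order q
... | yes h' = 0 , x , s≤s z≤n , h' , refl
... | no h' with locate ps (x ∸ order q) (∸-lt)
  where
  ∸-lt : x ∸ order q < vertexCount ps
  ∸-lt = +-cancelˡ-< (order q) (x ∸ order q) (vertexCount ps) (≤-trans (≤-reflexive (cong suc (m+[n∸m]≡n (≮⇒≥ h')))) h)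
...   | p , l , p<len , l<order , e = suc p , l , s≤s p<len , l<order ,
        trans (sym (m+[n∸m]≡n (≮⇒≥ h'))) (trans (cong (order q +_) e) (sym (+-assoc (order q) (offset ps p) l)))

unicyclic : List (ℕ × ℕ) → Graph
unicyclic ps = U (map tstar ps)

n-unicyclic : ∀ ps → n (unicyclic ps) ≡ vertexCount ps
n-unicyclic [] = refl
n-unicyclic ((a , b) ∷ ps) = cong (a + a + b + 1 +_) (n-unicyclic ps)

TstarEdgeOf : ℕ × ℕ → ℕ → ℕ → Set
TstarEdgeOf (a , b) = TstarEdge a b

∈-treeEdges⁺ : ∀ o ps p {l1 l2} → p < length ps → TstarEdgeOf (treeAt ps p) l1 l2 → (o + (offset ps p + l1) , o + (offset ps p + l2)) ∈ treeEdges o (map tstar ps)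
∈-treeEdges⁺ o ((a , b) ∷ ps) zero _ le = ∈-++⁺ˡ (∈-map⁺ (λ { (x , y) → (o + x , o + y) }) (∈-tedges⁺ a b le))
∈-treeEdges⁺ o ((a , b) ∷ ps) (suc p) {l1} {l2} (s≤s p<len) le =
  ∈-++⁺ʳ (shift o (tedges (Tstar a b))) (subst (_∈ treeEdges (o + order (a , b)) (map tstar ps)) (cong₂ _,_ (f l1) (f l2)) (∈-treeEdges⁺ (o + order (a , b)) ps p p<len le))
  where
  f : ∀ l → o + order (a , b) + (offset ps p + l) ≡ o + (order (a , b) + offset ps p + l)
  f l = trans (+-assoc o _ _) (cong (o +_) (sym (+-assoc (order (a , b)) (offset ps p) l)))

∈-treeEdges⁻ : ∀ o ps {x y} → (x , y) ∈ treeEdges o (map tstar ps) →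
  ∃ λ p → ∃₂ λ l1 l2 → p < length ps × TstarEdgeOf (treeAt ps p) l1 l2 × x ≡ o + (offset ps p + l1) × y ≡ o + (offset ps p + l2)
∈-treeEdges⁻ o ((a , b) ∷ ps) m with ∈-++⁻ (shift o (tedges (Tstar a b))) m
... | inj₁ m' with ∈-map⁻ (λ { (x , y) → (o + x , o + y) }) m'
...   | (l1 , l2) , ml , refl = 0 , l1 , l2 , s≤s z≤n , ∈-tedges⁻ a b ml , refl , refl
∈-treeEdges⁻ o ((a , b) ∷ ps) m | inj₂ m' with ∈-treeEdges⁻ (o + order (a , b)) ps m'
...   | p , l1 , l2 , p<len , le , refl , refl = suc p , l1 , l2 , s≤s p<len , le , f l1 , f l2
  where
  f : ∀ l → o + order (a , b) + (offset ps p + l) ≡ o + (order (a , b) + offset ps p + l)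
  f l = trans (+-assoc o _ _) (cong (o +_) (sym (+-assoc (order (a , b)) (offset ps p) l)))

∈-pathEdges⁺ : ∀ o ps p → suc p < length ps → (o + offset ps p , o + offset ps (suc p)) ∈ pathEdges (roots o (map tstar ps))
∈-pathEdges⁺ o [] p ()
∈-pathEdges⁺ o ((a , b) ∷ []) p (s≤s ())
∈-pathEdges⁺ o ((a , b) ∷ (a' , b') ∷ ps) zero h = here (cong₂ _,_ (+-identityʳ o) (cong (o +_) (+-identityʳ _)))
∈-pathEdges⁺ o ((a , b) ∷ (a' , b') ∷ ps) (suc p) (s≤s h) =
  there (subst (_∈ pathEdges (roots (o + order (a , b)) (map tstar ((a' , b') ∷ ps))))
               (cong₂ _,_ (+-assoc o _ _) (+-assoc o _ _)) (∈-pathEdges⁺ (o + order (a , b)) ((a' , b') ∷ ps) p h))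

∈-pathEdges⁻ : ∀ o ps {x y} → (x , y) ∈ pathEdges (roots o (map tstar ps)) → Σ ℕ λ p → suc p < length ps × x ≡ o + offset ps p × y ≡ o + offset ps (suc p)
∈-pathEdges⁻ o [] ()
∈-pathEdges⁻ o ((a , b) ∷ []) ()
∈-pathEdges⁻ o ((a , b) ∷ (a' , b') ∷ ps) (here refl) = 0 , s≤s (s≤s z≤n) , sym (+-identityʳ o) , cong (o +_) (sym (+-identityʳ _))
∈-pathEdges⁻ o ((a , b) ∷ (a' , b') ∷ ps) (there m) with ∈-pathEdges⁻ (o + order (a , b)) ((a' , b') ∷ ps) m
... | p , h , e1 , e2 = suc p , s≤s h , trans e1 (+-assoc o _ _) , trans e2 (+-assoc o _ _)

lastOr-roots : ∀ d o q ps → lastOr d (roots o (map tstar (q ∷ ps))) ≡ o + offset (q ∷ ps) (length ps)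
lastOr-roots d o (a , b) [] = sym (+-identityʳ o)
lastOr-roots d o (a , b) (q' ∷ ps) = trans (lastOr-roots o (o + order (a , b)) q' ps) (+-assoc o _ _)

data UnicyclicEdge (ps : List (ℕ × ℕ)) (x y : ℕ) : Set where
  cycle-edge : ∀ p p' → p < length ps → Adjacent (length ps) p p' → x ≡ offset ps p → y ≡ offset ps p' → UnicyclicEdge ps x y
  tree-edge : ∀ p l1 l2 → p < length ps → TstarEdgeOf (treeAt ps p) l1 l2 → x ≡ offset ps p + l1 → y ≡ offset ps p + l2 → UnicyclicEdge ps x y

∈-edges⁻ : ∀ ps {x y} → (x , y) ∈ edges (unicyclic ps) → UnicyclicEdge ps x y
∈-edges⁻ ((a , b) ∷ ps) {x} {y} m with ∈-++⁻ (cycleEdges (roots 0 (map tstar ((a , b) ∷ ps)))) m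
... | inj₂ m' with ∈-treeEdges⁻ 0 ((a , b) ∷ ps) m'
...   | p , l1 , l2 , p<len , le , e1 , e2 = tree-edge p l1 l2 p<len le e1 e2
∈-edges⁻ ((a , b) ∷ ps) {x} {y} m | inj₁ m' with ∈-++⁻ (pathEdges (roots 0 (map tstar ((a , b) ∷ ps)))) m'
... | inj₁ m'' with ∈-pathEdges⁻ 0 ((a , b) ∷ ps) m''
...   | p , h , e1 , e2 = cycle-edge p (suc p) (<-trans (n<1+n p) h) (next h) e1 e2
∈-edges⁻ ((a , b) ∷ ps) {x} {y} m | inj₁ m' | inj₂ (here refl) =
  cycle-edge (length ps) 0 ≤-refl (next-wrap refl) (lastOr-roots 0 0 (a , b) ps) refl

treeEdge∈edges : ∀ ps p {l1 l2} → p < length ps → TstarEdgeOf (treeAt ps p) l1 l2 → (offset ps p + l1 , offset ps p + l2) ∈ edges (unicyclic ps)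
treeEdge∈edges ((a , b) ∷ ps) p h le = ∈-++⁺ʳ (cycleEdges (roots 0 (map tstar ((a , b) ∷ ps)))) (∈-treeEdges⁺ 0 ((a , b) ∷ ps) p h le)

pathEdge∈edges : ∀ ps p → suc p < length ps → (offset ps p , offset ps (suc p)) ∈ edges (unicyclic ps)
pathEdge∈edges ((a , b) ∷ ps) p h = ∈-++⁺ˡ (∈-++⁺ˡ (∈-pathEdges⁺ 0 ((a , b) ∷ ps) p h))

closingEdge∈edges : ∀ ps → (offset ps (length ps ∸ 1) , 0) ∈ edges (unicyclic ps) ⊎ length ps ≡ 0
closingEdge∈edges [] = inj₂ refl
closingEdge∈edges ((a , b) ∷ ps) = inj₁ (∈-++⁺ˡ (∈-++⁺ʳ (pathEdges (roots 0 (map tstar ((a , b) ∷ ps)))) (here (cong (_, 0) (sym (lastOr-roots 0 0 (a , b) ps))))))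

Adjacent⇒EdgeIn : ∀ ps {p p'} → p < length ps → Adjacent (length ps) p p' → EdgeIn (unicyclic ps) (offset ps p) (offset ps p')
Adjacent⇒EdgeIn ps p<len (next h) = inj₁ (pathEdge∈edges ps _ h)
Adjacent⇒EdgeIn ps p<len (prev refl) = inj₂ (pathEdge∈edges ps _ p<len)
Adjacent⇒EdgeIn ((a , b) ∷ ps) p<len (next-wrap e) rewrite suc-injective e with closingEdge∈edges ((a , b) ∷ ps)
... | inj₁ m = inj₁ m
Adjacent⇒EdgeIn ((a , b) ∷ ps) p<len (prev-wrap refl) with closingEdge∈edges ((a , b) ∷ ps)
... | inj₁ m = inj₂ m

0<order : ∀ q → 0 < order q
0<order (a , b) = ≤-trans (s≤s z≤n) (≤-reflexive (sym (order-suc a b)))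

spoke : ℕ → ℕ × ℕ
spoke b = (0 , b)

-- Distances in U(T*_{a₁,b₁}, …, T*_{a_g,b_g})

TreeDescent : ℕ → ℕ → ℕ → ℕ → ℕ → Set
TreeDescent g a b l m = Σ ℕ λ l' → l' < order (a , b) × (TstarEdge a b l l' ⊎ TstarEdge a b l' l) ×
   (∀ s → suc (descDist g (s , localDesc (a , b) l') (s , localDesc (a , b) m)) ≡ descDist g (s , localDesc (a , b) l) (s , localDesc (a , b) m))

treeDescent-root : ∀ g a b {m} → TstarVertex a b m → 0 ≢ m → TreeDescent g a b 0 m
treeDescent-root g a b root ne = ⊥-elim (ne refl)
treeDescent-root g a b (leaf j j1 j2) _ = j , leaf<order a b j j2 , inj₁ (leaf-edge j j1 j2) , λ s →
  begin suc (descDist g (s , localDesc (a , b) j) (s , localDesc (a , b) j)) ≡⟨ cong suc (descDist-refl g (s , localDesc (a , b) j)) ⟩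
        1 ≡⟨ sym (descDist-other-branch g s 0 0 1 j (<⇒≢ j1)) ⟩
        descDist g (s , 0 , 0) (s , 1 , j) ≡⟨ cong (λ t → descDist g (s , 0 , 0) (s , t)) (sym (localDesc-leaf a b j j1 j2)) ⟩
        descDist g (s , 0 , 0) (s , localDesc (a , b) j) ∎
  where open ≡-Reasoning
treeDescent-root g a b (pendant j j1 j2) _ = j , leaf<order a b j (≤-trans j2 (m≤m+n a b)) , inj₁ (leaf-edge j j1 (≤-trans j2 (m≤m+n a b))) , λ s →
  begin suc (descDist g (s , localDesc (a , b) j) (s , localDesc (a , b) (a + b + j)))
          ≡⟨ cong₂ (λ t u → suc (descDist g (s , t) (s , u))) (localDesc-leaf a b j j1 (≤-trans j2 (m≤m+n a b))) (localDesc-pendant a b j j1 j2) ⟩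
        suc (descDist g (s , 1 , j) (s , 2 , j)) ≡⟨ cong suc (descDist-same-branch g s 1 j 2) ⟩
        2 ≡⟨ sym (descDist-other-branch g s 0 0 2 j (<⇒≢ j1)) ⟩
        descDist g (s , 0 , 0) (s , 2 , j) ≡⟨ cong (λ t → descDist g (s , 0 , 0) (s , t)) (sym (localDesc-pendant a b j j1 j2)) ⟩
        descDist g (s , 0 , 0) (s , localDesc (a , b) (a + b + j)) ∎
  where open ≡-Reasoning
treeDescent-leaf : ∀ g a b {i m} → 1 ≤ i → i ≤ a + b → TstarVertex a b m → i ≢ m → TreeDescent g a b i m
treeDescent-leaf g a b {i} i1 i2 root _ = 0 , 0<order (a , b) , inj₂ (leaf-edge i i1 i2) , λ s →
  begin suc (descDist g (s , 0 , 0) (s , 0 , 0)) ≡⟨ cong suc (descDist-refl g (s , 0 , 0)) ⟩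
        1 ≡⟨ sym (descDist-other-branch g s 1 i 0 0 (λ e → <⇒≢ i1 (sym e))) ⟩
        descDist g (s , 1 , i) (s , 0 , 0) ≡⟨ cong (λ t → descDist g (s , t) (s , 0 , 0)) (sym (localDesc-leaf a b i i1 i2)) ⟩
        descDist g (s , localDesc (a , b) i) (s , 0 , 0) ∎
  where open ≡-Reasoning
treeDescent-leaf g a b {i} i1 i2 (leaf j j1 j2) ne = 0 , 0<order (a , b) , inj₂ (leaf-edge i i1 i2) , λ s →
  begin suc (descDist g (s , 0 , 0) (s , localDesc (a , b) j)) ≡⟨ cong (λ t → suc (descDist g (s , 0 , 0) (s , t))) (localDesc-leaf a b j j1 j2) ⟩
        suc (descDist g (s , 0 , 0) (s , 1 , j)) ≡⟨ cong suc (descDist-other-branch g s 0 0 1 j (<⇒≢ j1)) ⟩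
        2 ≡⟨ sym (descDist-other-branch g s 1 i 1 j ne) ⟩
        descDist g (s , 1 , i) (s , 1 , j) ≡⟨ cong₂ (λ t u → descDist g (s , t) (s , u)) (sym (localDesc-leaf a b i i1 i2)) (sym (localDesc-leaf a b j j1 j2)) ⟩
        descDist g (s , localDesc (a , b) i) (s , localDesc (a , b) j) ∎
  where open ≡-Reasoning
treeDescent-leaf g a b {i} i1 i2 (pendant j j1 j2) _ with i ≟ j
... | yes refl = a + b + i , pendant<order a b i j2 , inj₁ (pendant-edge i i1 j2) , λ s →
  begin suc (descDist g (s , localDesc (a , b) (a + b + i)) (s , localDesc (a , b) (a + b + i))) ≡⟨ cong suc (descDist-refl g (s , localDesc (a , b) (a + b + i))) ⟩
        1 ≡⟨ sym (descDist-same-branch g s 1 i 2) ⟩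
        descDist g (s , 1 , i) (s , 2 , i) ≡⟨ cong₂ (λ t u → descDist g (s , t) (s , u)) (sym (localDesc-leaf a b i i1 i2)) (sym (localDesc-pendant a b i j1 j2)) ⟩
        descDist g (s , localDesc (a , b) i) (s , localDesc (a , b) (a + b + i)) ∎
  where open ≡-Reasoning
... | no ij = 0 , 0<order (a , b) , inj₂ (leaf-edge i i1 i2) , λ s →
  begin suc (descDist g (s , 0 , 0) (s , localDesc (a , b) (a + b + j))) ≡⟨ cong (λ t → suc (descDist g (s , 0 , 0) (s , t))) (localDesc-pendant a b j j1 j2) ⟩
        suc (descDist g (s , 0 , 0) (s , 2 , j)) ≡⟨ cong suc (descDist-other-branch g s 0 0 2 j (<⇒≢ j1)) ⟩
        3 ≡⟨ sym (descDist-other-branch g s 1 i 2 j ij) ⟩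
        descDist g (s , 1 , i) (s , 2 , j) ≡⟨ cong₂ (λ t u → descDist g (s , t) (s , u)) (sym (localDesc-leaf a b i i1 i2)) (sym (localDesc-pendant a b j j1 j2)) ⟩
        descDist g (s , localDesc (a , b) i) (s , localDesc (a , b) (a + b + j)) ∎
  where open ≡-Reasoning
treeDescent-pendant : ∀ g a b {i m} → 1 ≤ i → i ≤ a → TstarVertex a b m → a + b + i ≢ m → TreeDescent g a b (a + b + i) m
treeDescent-pendant g a b {i} i1 i2 vm ne = i , leaf<order a b i li , inj₂ (pendant-edge i i1 i2) , λ s → eqn s vm ne
  where
  li = ≤-trans i2 (m≤m+n a b)
  open ≡-Reasoning
  eqn : ∀ s {m} → TstarVertex a b m → a + b + i ≢ m →
    suc (descDist g (s , localDesc (a , b) i) (s , localDesc (a , b) m)) ≡ descDist g (s , localDesc (a , b) (a + b + i)) (s , localDesc (a , b) m)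
  eqn s vm ne rewrite localDesc-leaf a b i i1 li | localDesc-pendant a b i i1 i2 = eqn′ s vm ne
    where
    eqn′ : ∀ s {m} → TstarVertex a b m → a + b + i ≢ m → suc (descDist g (s , 1 , i) (s , localDesc (a , b) m)) ≡ descDist g (s , 2 , i) (s , localDesc (a , b) m)
    eqn′ s root ne = trans (cong suc (descDist-other-branch g s 1 i 0 0 (λ e → <⇒≢ i1 (sym e)))) (sym (descDist-other-branch g s 2 i 0 0 (λ e → <⇒≢ i1 (sym e))))
    eqn′ s (leaf j j1 j2) ne rewrite localDesc-leaf a b j j1 j2 = lc (i ≟ j)
      where
      lc : Dec (i ≡ j) → suc (descDist g (s , 1 , i) (s , 1 , j)) ≡ descDist g (s , 2 , i) (s , 1 , j)
      lc (yes refl) = trans (cong suc (descDist-same-branch g s 1 i 1)) (sym (descDist-same-branch g s 2 i 1))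
      lc (no ij) = trans (cong suc (descDist-other-branch g s 1 i 1 j ij)) (sym (descDist-other-branch g s 2 i 1 j ij))
    eqn′ s (pendant j j1 j2) ne rewrite localDesc-pendant a b j j1 j2 = lc (i ≟ j)
      where
      lc : Dec (i ≡ j) → suc (descDist g (s , 1 , i) (s , 2 , j)) ≡ descDist g (s , 2 , i) (s , 2 , j)
      lc (yes refl) = ⊥-elim (ne refl)
      lc (no ij) = trans (cong suc (descDist-other-branch g s 1 i 2 j ij)) (sym (descDist-other-branch g s 2 i 2 j ij))

treeDescent : ∀ g a b l m → TstarVertex a b l → TstarVertex a b m → l ≢ m → TreeDescent g a b l m
treeDescent g a b _ _ root              = treeDescent-root g a b
treeDescent g a b _ _ (leaf i i1 i2)    = treeDescent-leaf g a b i1 i2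
treeDescent g a b _ _ (pendant i i1 i2) = treeDescent-pendant g a b i1 i2

δ : List (ℕ × ℕ) → ℕ → ℕ → ℕ
δ ps x z = descDist (length ps) (descriptor 0 ps x) (descriptor 0 ps z)

descriptor-at : ∀ ps p l → p < length ps → l < order (treeAt ps p) → descriptor 0 ps (offset ps p + l) ≡ (p , localDesc (treeAt ps p) l)
descriptor-at ps p l = descriptor-offset 0 ps p l

descriptor-root : ∀ ps p → p < length ps → descriptor 0 ps (offset ps p) ≡ (p , 0 , 0)
descriptor-root ps p p<len = trans (cong (descriptor 0 ps) (sym (+-identityʳ _))) (descriptor-at ps p 0 p<len (0<order (treeAt ps p)))

offset+<vertexCount : ∀ ps p l → p < length ps → l < order (treeAt ps p) → offset ps p + l < vertexCount ps
offset+<vertexCount (q ∷ ps) zero l _ h = ≤-trans h (m≤m+n (order q) (vertexCount ps))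
offset+<vertexCount (q ∷ ps) (suc p) l (s≤s p<len) h =
  ≤-trans (≤-reflexive (trans (cong suc (+-assoc (order q) (offset ps p) l)) (sym (+-suc (order q) _))))
          (+-monoʳ-≤ (order q) (offset+<vertexCount ps p l p<len h))

descriptor-position< : ∀ ps z → z < vertexCount ps → proj₁ (descriptor 0 ps z) < length ps
descriptor-position< ps z h with locate ps z h
... | p , l , p<len , l<order , refl rewrite descriptor-at ps p l p<len l<order = p<len

TstarEdge-bounds : ∀ q {l1 l2} → TstarEdgeOf q l1 l2 → l1 < order q × l2 < order q
TstarEdge-bounds (a , b) (leaf-edge i h1 h2) = 0<order (a , b) , leaf<order a b i h2
TstarEdge-bounds (a , b) (pendant-edge i h1 h2) = leaf<order a b i (≤-trans h2 (m≤m+n a b)) , pendant<order a b i h2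

Lipschitz-TstarEdge : ∀ g s q {l1 l2} → TstarEdgeOf q l1 l2 → ∀ z → Lipschitz g (s , localDesc q l1) (s , localDesc q l2) z
Lipschitz-TstarEdge g s (a , b) (leaf-edge i h1 h2) z rewrite localDesc-leaf a b i h1 h2 = Lipschitz-treeEdge g s 0 i 0 z (inj₁ (refl , refl))
Lipschitz-TstarEdge g s (a , b) (pendant-edge i h1 h2) z rewrite localDesc-leaf a b i h1 (≤-trans h2 (m≤m+n a b)) | localDesc-pendant a b i h1 h2 = Lipschitz-treeEdge g s 1 i i z (inj₂ refl)

δ-lipschitz : ∀ ps x y z → (x , y) ∈ edges (unicyclic ps) → z < vertexCount ps → Lipschitz (length ps) (descriptor 0 ps x) (descriptor 0 ps y) (descriptor 0 ps z)
δ-lipschitz ps x y z m zh with ∈-edges⁻ ps m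
... | cycle-edge p p' p<len adj refl refl rewrite descriptor-root ps p p<len | descriptor-root ps p' (Adjacent-< adj p<len) = Lipschitz-cycleEdge (length ps) p p' (descriptor 0 ps z) adj p<len (descriptor-position< ps z zh)
... | tree-edge p l1 l2 p<len le refl refl rewrite descriptor-at ps p l1 p<len (proj₁ (TstarEdge-bounds (treeAt ps p) le)) | descriptor-at ps p l2 p<len (proj₂ (TstarEdge-bounds (treeAt ps p) le)) =
  Lipschitz-TstarEdge (length ps) p (treeAt ps p) le (descriptor 0 ps z)

TstarVertexOf : ℕ × ℕ → ℕ → Set
TstarVertexOf q = TstarVertex (proj₁ q) (proj₂ q)

tstarVertexOf : ∀ q l → l < order q → TstarVertexOf q l
tstarVertexOf q l h = tstarVertex (proj₁ q) (proj₂ q) l h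

Descent : List (ℕ × ℕ) → ℕ → Descriptor → Descriptor → Set
Descent ps x dx dz = Σ ℕ λ y → y < vertexCount ps × EdgeIn (unicyclic ps) x y × suc (descDist (length ps) (descriptor 0 ps y) dz) ≡ descDist (length ps) dx dz

descent-other-tree : ∀ ps p l q k j → p < length ps → q < length ps → p ≢ q → TstarVertexOf (treeAt ps p) l →
  Descent ps (offset ps p + l) (p , localDesc (treeAt ps p) l) (q , k , j)
descent-other-tree ps p _ q k j p<len q<len p≢q root with cycleDist-descent (length ps) p q p<len q<len p≢q
... | p' , adj , descends = offset ps p' , subst (_< vertexCount ps) (+-identityʳ _) (offset+<vertexCount ps p' 0 (Adjacent-< adj p<len) (0<order (treeAt ps p'))) ,
      subst (λ t → EdgeIn (unicyclic ps) t (offset ps p')) (sym (+-identityʳ _)) (Adjacent⇒EdgeIn ps p<len adj) ,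
      trans (cong (λ t → suc (descDist (length ps) t (q , k , j))) (descriptor-root ps p' (Adjacent-< adj p<len))) (finish (p' ≟ q))
  where
  g = length ps
  finish : Dec (p' ≡ q) → suc (descDist g (p' , 0 , 0) (q , k , j)) ≡ descDist g (p , 0 , 0) (q , k , j)
  finish (yes refl) rewrite descDist-root-same g p' k j | descDist-≢ g p 0 0 p' k j p≢q | sym descends | cycleDist-refl g p' = +-comm 1 k
  finish (no n) rewrite descDist-≢ g p' 0 0 q k j n | descDist-≢ g p 0 0 q k j p≢q | sym descends = sym (+-suc k _)
descent-other-tree ps p _ q k j p<len q<len p≢q (leaf i i1 i2) =
  offset ps p + 0 , offset+<vertexCount ps p 0 p<len (0<order (treeAt ps p)) , inj₂ (treeEdge∈edges ps p p<len (leaf-edge i i1 i2)) ,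
  trans (cong (λ t → suc (descDist (length ps) t (q , k , j))) (descriptor-at ps p 0 p<len (0<order (treeAt ps p))))
        (trans (cong suc (descDist-≢ (length ps) p 0 0 q k j p≢q))
        (sym (trans (cong (λ t → descDist (length ps) (p , t) (q , k , j)) (localDesc-leaf (proj₁ (treeAt ps p)) (proj₂ (treeAt ps p)) i i1 i2)) (descDist-≢ (length ps) p 1 i q k j p≢q))))
descent-other-tree ps p _ q k j p<len q<len p≢q (pendant i i1 i2) =
  offset ps p + i , offset+<vertexCount ps p i p<len (leaf<order (proj₁ (treeAt ps p)) (proj₂ (treeAt ps p)) i li) , inj₂ (treeEdge∈edges ps p p<len (pendant-edge i i1 i2)) ,
  trans (cong (λ t → suc (descDist (length ps) t (q , k , j))) (trans (descriptor-at ps p i p<len (leaf<order (proj₁ (treeAt ps p)) (proj₂ (treeAt ps p)) i li)) (cong (p ,_) (localDesc-leaf (proj₁ (treeAt ps p)) (proj₂ (treeAt ps p)) i i1 li))))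
        (trans (cong suc (descDist-≢ (length ps) p 1 i q k j p≢q))
        (sym (trans (cong (λ t → descDist (length ps) (p , t) (q , k , j)) (localDesc-pendant (proj₁ (treeAt ps p)) (proj₂ (treeAt ps p)) i i1 i2)) (descDist-≢ (length ps) p 2 i q k j p≢q))))
  where li = ≤-trans i2 (m≤m+n (proj₁ (treeAt ps p)) (proj₂ (treeAt ps p)))

descent-same-tree : ∀ ps p l m → p < length ps → l < order (treeAt ps p) → m < order (treeAt ps p) → l ≢ m →
  Descent ps (offset ps p + l) (p , localDesc (treeAt ps p) l) (p , localDesc (treeAt ps p) m)
descent-same-tree ps p l m p<len l<order m<order l≢m with treeDescent (length ps) (proj₁ (treeAt ps p)) (proj₂ (treeAt ps p)) l m (tstarVertexOf _ l l<order) (tstarVertexOf _ m m<order) l≢m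
... | l' , l'<order , ed , eq = offset ps p + l' , offset+<vertexCount ps p l' p<len l'<order ,
      edg ed ,
      trans (cong (λ t → suc (descDist (length ps) t (p , localDesc (treeAt ps p) m))) (descriptor-at ps p l' p<len l'<order)) (eq p)
  where
  edg : TstarEdgeOf (treeAt ps p) l l' ⊎ TstarEdgeOf (treeAt ps p) l' l → EdgeIn (unicyclic ps) (offset ps p + l) (offset ps p + l')
  edg (inj₁ e) = inj₁ (treeEdge∈edges ps p p<len e)
  edg (inj₂ e) = inj₂ (treeEdge∈edges ps p p<len e)

descent-located : ∀ ps p l q m → p < length ps → l < order (treeAt ps p) → q < length ps → m < order (treeAt ps q) →
  offset ps p + l ≢ offset ps q + m → Dec (p ≡ q) →
  Descent ps (offset ps p + l) (p , localDesc (treeAt ps p) l) (q , localDesc (treeAt ps q) m)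
descent-located ps p l q m p<len l<order q<len m<order ne (no p≢q) = descent-other-tree ps p l q _ _ p<len q<len p≢q (tstarVertexOf _ l l<order)
descent-located ps p l p m p<len l<order q<len m<order ne (yes refl) with l ≟ m
... | yes refl = ⊥-elim (ne refl)
... | no l≢m = descent-same-tree ps p l m p<len l<order m<order l≢m

δ-descent : ∀ ps x z → x < vertexCount ps → z < vertexCount ps → x ≢ z → Σ ℕ λ y → y < vertexCount ps × EdgeIn (unicyclic ps) x y × suc (δ ps y z) ≡ δ ps x z
δ-descent ps x z xh zh ne with locate ps x xh | locate ps z zh
... | p , l , p<len , l<order , refl | q , m , q<len , m<order , refl rewrite descriptor-at ps q m q<len m<order | descriptor-at ps p l p<len l<order =
  descent-located ps p l q m p<len l<order q<len m<order ne (p ≟ q)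

localDesc-depth≤2 : ∀ q l → proj₁ (localDesc q l) ≤ 2
localDesc-depth≤2 (a , b) l with l ≟ 0 | l ≤? a + b
... | yes _ | _ = z≤n
... | no _ | yes _ = s≤s z≤n
... | no _ | no _ = ≤-refl

descriptor-depth≤2 : ∀ s ps x → proj₁ (proj₂ (descriptor s ps x)) ≤ 2
descriptor-depth≤2 s [] x = z≤n
descriptor-depth≤2 s (q ∷ ps) x with x <? order q
... | yes _ = localDesc-depth≤2 q x
... | no _ = descriptor-depth≤2 (suc s) ps (x ∸ order q)

δ≤4+g : ∀ ps x z → δ ps x z ≤ 4 + length ps
δ≤4+g ps x z = ≤-trans (descDist≤ (length ps) (proj₁ X) (proj₁ (proj₂ X)) (proj₂ (proj₂ X)) (proj₁ Z) (proj₁ (proj₂ Z)) (proj₂ (proj₂ Z)))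
   (+-mono-≤ (+-mono-≤ (descriptor-depth≤2 0 ps x) (descriptor-depth≤2 0 ps z)) (cycleDist≤g (length ps) (proj₁ X) (proj₁ Z)))
  where X = descriptor 0 ps x
        Z = descriptor 0 ps z

δ-certificate : ∀ ps → 4 + length ps ≤ vertexCount ps → DistanceCertificate (unicyclic ps) (δ ps)
δ-certificate ps bnd = record
  { lipschitz = λ x y z m zh → δ-lipschitz ps x y z m (<n⇒<vertexCount zh)
  ; diagonal = λ x _ → descDist-refl (length ps) (descriptor 0 ps x)
  ; descent = λ x z xh zh ne → map₂ (map₁ (subst (_ <_) (sym (n-unicyclic ps)))) (δ-descent ps x z (<n⇒<vertexCount xh) (<n⇒<vertexCount zh) ne)
  ; bounded = λ x z _ _ → ≤-trans (δ≤4+g ps x z) (≤-trans bnd (≤-reflexive (sym (n-unicyclic ps))))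
  }
  where
  <n⇒<vertexCount : ∀ {z} → z < n (unicyclic ps) → z < vertexCount ps
  <n⇒<vertexCount = subst (_ <_) (n-unicyclic ps)

dist-unicyclic : ∀ ps → 4 + length ps ≤ vertexCount ps → ∀ (u v : Fin (n (unicyclic ps))) → dist (unicyclic ps) u v ≡ δ ps (toℕ u) (toℕ v)
dist-unicyclic ps bnd = Certified.dist≡δ (δ-certificate ps bnd)

-- Invariance under isomorphism

T-⇔⇒≡ : ∀ {a b : Bool} → (T a → T b) → (T b → T a) → a ≡ b
T-⇔⇒≡ {false} {false} _ _ = refl
T-⇔⇒≡ {false} {true}  _ g = ⊥-elim (g tt)
T-⇔⇒≡ {true}  {false} f _ = ⊥-elim (f tt)
T-⇔⇒≡ {true}  {true}  _ _ = refl

module FinSum = CSum +-0-commutativeMonoid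

sum-allFin : ∀ n (h : Fin n → ℕ) → sum (map h (allFin n)) ≡ FinSum.sum h
sum-allFin zero    h = refl
sum-allFin (suc n) h = cong (h Fin.zero +_) (begin
  sum (map h (tabulate Fin.suc))        ≡⟨ cong sum (map-tabulate Fin.suc h) ⟩
  sum (tabulate (h ∘ Fin.suc))          ≡⟨ cong sum (map-tabulate (λ i → i) (h ∘ Fin.suc)) ⟨
  sum (map (h ∘ Fin.suc) (allFin n))    ≡⟨ sum-allFin n (h ∘ Fin.suc) ⟩
  FinSum.sum (h ∘ Fin.suc)              ∎)
  where open ≡-Reasoning

sum-permute : ∀ {m n} (π : Fin m ↔ Fin n) (h : Fin n → ℕ) →
  sum (map (h ∘ Inverse.to π) (allFin m)) ≡ sum (map h (allFin n))
sum-permute {m} {n} π h = begin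
  sum (map (h ∘ Inverse.to π) (allFin m))  ≡⟨ sum-allFin m (h ∘ Inverse.to π) ⟩
  FinSum.sum (h ∘ Inverse.to π)            ≡⟨ FinSum.sum-permute h π ⟨
  FinSum.sum h                             ≡⟨ sum-allFin n h ⟨
  sum (map h (allFin n))                   ∎
  where open ≡-Reasoning

distanceSum : Graph → ℕ
distanceSum G = sum (map (λ u → sum (map (dist G u) (allFin (n G)))) (allFin (n G)))

module _ (G H : Graph) (iso : Iso G H) where
  private
    φ : Fin (n G) → Fin (n H)
    φ = Inverse.to (proj₁ iso)
    φ⁻¹ : Fin (n H) → Fin (n G)
    φ⁻¹ = Inverse.from (proj₁ iso)
    φφ⁻¹ : ∀ y → φ (φ⁻¹ y) ≡ y
    φφ⁻¹ = Inverse.strictlyInverseˡ (proj₁ iso)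
    φ⁻¹φ : ∀ x → φ⁻¹ (φ x) ≡ x
    φ⁻¹φ = Inverse.strictlyInverseʳ (proj₁ iso)
    adj-φ : ∀ u v → Adj G u v ⇔ Adj H (φ u) (φ v)
    adj-φ = proj₂ iso

  reach-Iso : ∀ k u v → reach G k u v ≡ reach H k (φ u) (φ v)
  reach-Iso zero u v = T-⇔⇒≡
    (λ t → ≡⇒≡ᵇ _ _ (cong (toℕ ∘ φ) (toℕ-injective (≡ᵇ⇒≡ _ _ t))))
    (λ t → ≡⇒≡ᵇ _ _ (cong toℕ (trans (sym (φ⁻¹φ u)) (trans (cong φ⁻¹ (toℕ-injective (≡ᵇ⇒≡ _ _ t))) (φ⁻¹φ v)))))
  reach-Iso (suc k) u v = T-⇔⇒≡ forth back
    where
    forth : T (reach G (suc k) u v) → T (reach H (suc k) (φ u) (φ v))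
    forth t with to T-∨ t
    ... | inj₁ r = from T-∨ (inj₁ (subst T (reach-Iso k u v) r))
    ... | inj₂ r with any⇒∃ (λ w → adjb G u w ∧ reach G k w v) (allFin (n G)) r
    ...   | w , _ , c with to T-∧ c
    ...     | uw , wv = from T-∨ (inj₂ (∈∧T⇒any (λ w' → adjb H (φ u) w' ∧ reach H k w' (φ v)) (∈-allFin (φ w))
                          (from T-∧ (to (adj-φ u w) uw , subst T (reach-Iso k w v) wv))))
    back : T (reach H (suc k) (φ u) (φ v)) → T (reach G (suc k) u v)
    back t with to T-∨ t
    ... | inj₁ r = from T-∨ (inj₁ (subst T (sym (reach-Iso k u v)) r))
    ... | inj₂ r with any⇒∃ (λ w' → adjb H (φ u) w' ∧ reach H k w' (φ v)) (allFin (n H)) r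
    ...   | w' , _ , c with to T-∧ c
    ...     | uw , wv = from T-∨ (inj₂ (∈∧T⇒any (λ w → adjb G u w ∧ reach G k w v) (∈-allFin (φ⁻¹ w'))
                          (from T-∧ (from (adj-φ u (φ⁻¹ w')) (subst (T ∘ adjb H (φ u)) (sym (φφ⁻¹ w')) uw) ,
                                     subst T (sym (reach-Iso k (φ⁻¹ w') v)) (subst (λ x → T (reach H k x (φ v))) (sym (φφ⁻¹ w')) wv)))))

  distSearch-Iso : ∀ u v k f → distSearch G u v k f ≡ distSearch H (φ u) (φ v) k f
  distSearch-Iso u v k zero = refl
  distSearch-Iso u v k (suc f) rewrite reach-Iso k u v | distSearch-Iso u v (suc k) f = refl

  dist-Iso : ∀ u v → dist G u v ≡ dist H (φ u) (φ v)
  dist-Iso u v = trans (distSearch-Iso u v 0 (n G)) (cong (distSearch H (φ u) (φ v) 0) (↔⇒≡ (proj₁ iso)))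

  distanceSum-Iso : distanceSum G ≡ distanceSum H
  distanceSum-Iso = begin
    distanceSum G
      ≡⟨ sum-map-cong (allFin (n G)) (λ u → sum-map-cong (allFin (n G)) (dist-Iso u)) ⟩
    sum (map (λ u → sum (map (dist H (φ u) ∘ φ) (allFin (n G)))) (allFin (n G)))
      ≡⟨ sum-map-cong (allFin (n G)) (λ u → sum-permute (proj₁ iso) (dist H (φ u))) ⟩
    sum (map (λ u → sum (map (dist H (φ u)) (allFin (n H)))) (allFin (n G)))
      ≡⟨ sum-permute (proj₁ iso) (λ w → sum (map (dist H w) (allFin (n H)))) ⟩
    distanceSum H ∎
    where open ≡-Reasoning

-- The Wiener index as a sum over descriptors

below : (ℕ → ℕ → ℕ) → ℕ → ℕ → ℕ
below F i j = if i <ᵇ j then F i j else 0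

pairSum : ∀ {A : Set} → (A → A → ℕ) → List A → ℕ
pairSum F L = sum (map (λ i → sum (map (F i) L)) L)

<ᵇ-false : ∀ i j → j ≤ i → (i <ᵇ j) ≡ false
<ᵇ-false i j h with i <ᵇ j in eq
... | false = refl
... | true = ⊥-elim (<⇒≱ (<ᵇ⇒< i j (subst T (sym eq) _)) h)

<ᵇ-true : ∀ i j → i < j → (i <ᵇ j) ≡ true
<ᵇ-true i j h with i <ᵇ j in eq
... | true = refl
... | false = ⊥-elim (subst T eq (<⇒<ᵇ h))

below-split : ∀ (F : ℕ → ℕ → ℕ) → (∀ i j → F i j ≡ F j i) → (∀ i → F i i ≡ 0) → ∀ i j → F i j ≡ below F i j + below F j i
below-split F sy z i j with <-cmp i j
... | tri< lt _ _ rewrite <ᵇ-true i j lt | <ᵇ-false j i (<⇒≤ lt) = sym (+-identityʳ _)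
... | tri≈ _ refl _ rewrite <ᵇ-false i i ≤-refl = z i
... | tri> _ _ gt rewrite <ᵇ-true j i gt | <ᵇ-false i j (<⇒≤ gt) = sy i j

pairSum-below : ∀ (F : ℕ → ℕ → ℕ) → (∀ i j → F i j ≡ F j i) → (∀ i → F i i ≡ 0) → ∀ L → pairSum F L ≡ 2 * pairSum (below F) L
pairSum-below F sy z L = begin
  pairSum F L ≡⟨ sum-map-cong L (λ i → sum-map-cong L (λ j → below-split F sy z i j)) ⟩
  sum (map (λ i → sum (map (λ j → below F i j + below F j i) L)) L) ≡⟨ sum-map-cong L (λ i → sum-map-+ (below F i) (λ j → below F j i) L) ⟩
  sum (map (λ i → sum (map (below F i) L) + sum (map (λ j → below F j i) L)) L) ≡⟨ sum-map-+ _ _ L ⟩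
  pairSum (below F) L + sum (map (λ i → sum (map (λ j → below F j i) L)) L) ≡⟨ cong (pairSum (below F) L +_) (sym (sum-map-swap (below F) L L)) ⟩
  pairSum (below F) L + pairSum (below F) L ≡⟨ cong (pairSum (below F) L +_) (sym (+-identityʳ _)) ⟩
  2 * pairSum (below F) L ∎
  where open ≡-Reasoning

pairSum-map : ∀ {A B : Set} (F : B → B → ℕ) (f : A → B) L → pairSum F (map f L) ≡ pairSum (λ i j → F (f i) (f j)) L
pairSum-map F f L = begin
  sum (map (λ y → sum (map (F y) (map f L))) (map f L))  ≡⟨ cong sum (map-∘ L) ⟨
  sum (map (λ i → sum (map (F (f i)) (map f L))) L)      ≡⟨ sum-map-cong L (λ i → cong sum (map-∘ L)) ⟨
  pairSum (λ i j → F (f i) (f j)) L                      ∎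
  where open ≡-Reasoning

pairSum-allFin : ∀ n (F : ℕ → ℕ → ℕ) →
  sum (map (λ u → sum (map (λ v → F (toℕ u) (toℕ v)) (allFin n))) (allFin n)) ≡ pairSum F (upTo n)
pairSum-allFin n F = begin
  sum (map (λ u → sum (map (λ v → F (toℕ u) (toℕ v)) (allFin n))) (allFin n))
    ≡⟨ sum-map-cong (allFin n) (λ u → cong sum (map-allFin-toℕ n (F (toℕ u)))) ⟩
  sum (map (λ u → sum (map (F (toℕ u)) (upTo n))) (allFin n))
    ≡⟨ cong sum (map-allFin-toℕ n (λ i → sum (map (F i) (upTo n)))) ⟩
  pairSum F (upTo n) ∎
  where open ≡-Reasoning

pairSum-δ : ∀ ps → pairSum (δ ps) (upTo (n (unicyclic ps))) ≡
  pairSum (descDist (length ps)) (applyUpTo (descriptor 0 ps) (n (unicyclic ps)))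
pairSum-δ ps = trans (sym (pairSum-map (descDist (length ps)) (descriptor 0 ps) (upTo n')))
                     (cong (pairSum (descDist (length ps))) (map-upTo (descriptor 0 ps) n'))
  where n' = n (unicyclic ps)

2W-unicyclic : ∀ ps → 4 + length ps ≤ vertexCount ps →
  2 * W (unicyclic ps) ≡ pairSum (descDist (length ps)) (applyUpTo (descriptor 0 ps) (n (unicyclic ps)))
2W-unicyclic ps bnd = begin
  2 * W (unicyclic ps)                  ≡⟨ cong (2 *_) (trans (sum-map-cong (allFin n') (λ u → sum-map-cong (allFin n') (λ v →
                                             cong (if toℕ u <ᵇ toℕ v then_else 0) (dist-unicyclic ps bnd u v))))
                                             (pairSum-allFin n' (below (δ ps)))) ⟩
  2 * pairSum (below (δ ps)) (upTo n')  ≡⟨ pairSum-below (δ ps) (λ i j → descDist-sym (length ps) (descriptor 0 ps i) (descriptor 0 ps j))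
                                                           (λ i → descDist-refl (length ps) (descriptor 0 ps i)) (upTo n') ⟨
  pairSum (δ ps) (upTo n')              ≡⟨ pairSum-δ ps ⟩
  pairSum (descDist (length ps)) (applyUpTo (descriptor 0 ps) n') ∎
  where
  open ≡-Reasoning
  n' = n (unicyclic ps)

2W≡distanceSum : ∀ ps → 4 + length ps ≤ vertexCount ps → 2 * W (unicyclic ps) ≡ distanceSum (unicyclic ps)
2W≡distanceSum ps bnd = begin
  2 * W (unicyclic ps)                                            ≡⟨ 2W-unicyclic ps bnd ⟩
  pairSum (descDist (length ps)) (applyUpTo (descriptor 0 ps) n') ≡⟨ pairSum-δ ps ⟨
  pairSum (δ ps) (upTo n')                                        ≡⟨ pairSum-allFin n' (δ ps) ⟨
  sum (map (λ u → sum (map (λ v → δ ps (toℕ u) (toℕ v)) (allFin n'))) (allFin n'))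
    ≡⟨ sum-map-cong (allFin n') (λ u → sum-map-cong (allFin n') (λ v → dist-unicyclic ps bnd u v)) ⟨
  distanceSum (unicyclic ps) ∎
  where
  open ≡-Reasoning
  n' = n (unicyclic ps)

-- Moving leaves into the first tree

blockSum : ℕ → List Descriptor → List Descriptor → ℕ
blockSum g X Y = sum (map (λ x → sum (map (descDist g x) Y)) X)

blockSum-++ˡ : ∀ g X X' Y → blockSum g (X ++ X') Y ≡ blockSum g X Y + blockSum g X' Y
blockSum-++ˡ g X X' Y = sum-map-++ (λ x → sum (map (descDist g x) Y)) X X'

blockSum-++ʳ : ∀ g X Y Y' → blockSum g X (Y ++ Y') ≡ blockSum g X Y + blockSum g X Y'
blockSum-++ʳ g X Y Y' = trans (sum-map-cong X (λ x → sum-map-++ (descDist g x) Y Y')) (sum-map-+ _ _ X)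

blockSum-↭ : ∀ g {X X' Y Y'} → X ↭ X' → Y ↭ Y' → blockSum g X Y ≡ blockSum g X' Y'
blockSum-↭ g {X} {X'} {Y} {Y'} p q = trans (sum-map-↭ (λ x → sum (map (descDist g x) Y)) p) (sum-map-cong X' (λ x → sum-map-↭ (descDist g x) q))

blockSum-sym : ∀ g X Y → blockSum g X Y ≡ blockSum g Y X
blockSum-sym g X Y = trans (sum-map-swap (descDist g) X Y) (sum-map-cong Y (λ y → sum-map-cong X (λ x → descDist-sym g x y)))

blockSum-++ : ∀ g X Y → blockSum g (X ++ Y) (X ++ Y) ≡ blockSum g X X + 2 * blockSum g X Y + blockSum g Y Y
blockSum-++ g X Y = begin
  blockSum g (X ++ Y) (X ++ Y) ≡⟨ blockSum-++ˡ g X Y (X ++ Y) ⟩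
  blockSum g X (X ++ Y) + blockSum g Y (X ++ Y) ≡⟨ cong₂ _+_ (blockSum-++ʳ g X X Y) (blockSum-++ʳ g Y X Y) ⟩
  (blockSum g X X + blockSum g X Y) + (blockSum g Y X + blockSum g Y Y) ≡⟨ cong (λ t → (blockSum g X X + blockSum g X Y) + (t + blockSum g Y Y)) (blockSum-sym g Y X) ⟩
  (blockSum g X X + blockSum g X Y) + (blockSum g X Y + blockSum g Y Y) ≡⟨ collect (blockSum g X X) (blockSum g X Y) (blockSum g Y Y) ⟩
  blockSum g X X + 2 * blockSum g X Y + blockSum g Y Y ∎
  where
  open ≡-Reasoning
  collect : ∀ a b c → (a + b) + (b + c) ≡ a + 2 * b + c
  collect = solve-∀

blockSum-bounded : ∀ g c X Y → All (λ x → All (λ y → descDist g x y ≤ c) Y) X → blockSum g X Y ≤ length X * (length Y * c)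
blockSum-bounded g c [] Y [] = ≤-refl
blockSum-bounded g c (x ∷ X) Y (p ∷ ps) = +-mono-≤ (≤-trans (sum-map-mono {f = descDist g x} {h = λ _ → c} Y p) (≤-reflexive (sum-map-const c Y))) (blockSum-bounded g c X Y ps)

columnSum : ℕ → List Descriptor → Descriptor → ℕ
columnSum g A y = sum (map (λ x → descDist g x y) A)

blockSum-columns : ∀ g A B → blockSum g A B ≡ sum (map (columnSum g A) B)
blockSum-columns g A B = sum-map-swap (descDist g) A B

sum-pairwise-≥ : ∀ {A : Set} (F : A → ℕ) c {P Q : A → Set} xs ys → length xs ≡ length ys → All P xs → All Q ys →
  (∀ {x y} → P x → Q y → F y + c ≤ F x) → sum (map F ys) + length ys * c ≤ sum (map F xs)
sum-pairwise-≥ F c [] [] e [] [] h = ≤-refl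
sum-pairwise-≥ F c (x ∷ xs) (y ∷ ys) e (px ∷ pxs) (qy ∷ qys) h = begin
  F y + sum (map F ys) + (c + length ys * c) ≡⟨ interchange (F y) (sum (map F ys)) c (length ys * c) ⟩
  (F y + c) + (sum (map F ys) + length ys * c) ≤⟨ +-mono-≤ (h px qy) (sum-pairwise-≥ F c xs ys (suc-injective e) pxs qys h) ⟩
  F x + sum (map F xs) ∎
  where
  open ≤-Reasoning

InFirstTree : ℕ → Descriptor → Set
InFirstTree m x = proj₁ x ≡ 0 × proj₂ (proj₂ x) ≤ m

OtherRoot : ℕ → Descriptor → Set
OtherRoot g x = Σ ℕ λ p → x ≡ (p , 0 , 0) × 1 ≤ p × p < g

SpokeLeaf : ℕ → Descriptor → Set
SpokeLeaf g x = Σ ℕ λ j → Σ ℕ λ i → x ≡ (j , 1 , suc i) × 1 ≤ j × j < g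

NewLeaf : ℕ → Descriptor → Set
NewLeaf m x = Σ ℕ λ k → x ≡ (0 , 1 , k) × m < k

descDist-root-leaf : ∀ g p j i → descDist g (p , 0 , 0) (j , 1 , suc i) ≡ 1 + cycleDist g p j
descDist-root-leaf g p j i = go (p ≟ j)
  where
  go : Dec (p ≡ j) → descDist g (p , 0 , 0) (j , 1 , suc i) ≡ 1 + cycleDist g p j
  go (yes refl) rewrite descDist-other-branch g p 0 0 1 (suc i) (λ ()) | cycleDist-refl g p = refl
  go (no n) = descDist-≢ g p 0 0 j 1 (suc i) n

-- Moving a leaf from tree j to tree 0 brings every vertex of tree 0 closer by c = d(0, j) and
-- pushes each other root away by at most c, so a first tree outnumbering the other roots by
-- g + 2 makes the column sum drop by at least g + 2.
spokeLeaf-gain : ∀ g m T R {old new} → All (InFirstTree m) T → All (OtherRoot g) R → length R + (g + 2) ≤ length T →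
  SpokeLeaf g old → NewLeaf m new → columnSum g (T ++ R) new + (g + 2) ≤ columnSum g (T ++ R) old
spokeLeaf-gain g m T R allT allR T-large (j , i , refl , 1≤j , j<g) (k , refl , m<k) =
  +-cancelʳ-≤ (length R * c) _ _ (begin
    columnSum g (T ++ R) new + (g + 2) + length R * c
      ≡⟨ cong (λ s → s + (g + 2) + length R * c) (sum-map-++ (λ x → descDist g x new) T R) ⟩
    columnSum g T new + columnSum g R new + (g + 2) + length R * c
      ≡⟨ rearrange (columnSum g T new) (columnSum g R new) (g + 2) (length R * c) ⟩
    columnSum g T new + (length R * c + (g + 2)) + columnSum g R new
      ≤⟨ +-monoˡ-≤ (columnSum g R new) (+-monoʳ-≤ (columnSum g T new) R+g+2≤T) ⟩
    columnSum g T new + length T * c + columnSum g R new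
      ≡⟨ cong (_+ columnSum g R new) column-T ⟨
    columnSum g T old + columnSum g R new
      ≤⟨ +-monoʳ-≤ (columnSum g T old) column-R ⟩
    columnSum g T old + (columnSum g R old + length R * c)
      ≡⟨ +-assoc (columnSum g T old) _ _ ⟨
    columnSum g T old + columnSum g R old + length R * c
      ≡⟨ cong (_+ length R * c) (sum-map-++ (λ x → descDist g x old) T R) ⟨
    columnSum g (T ++ R) old + length R * c ∎)
  where
  open ≤-Reasoning
  c = cycleDist g 0 j
  old = (j , 1 , suc i)
  new = (0 , 1 , k)
  1≤c : 1 ≤ c
  1≤c with c ≟ 0
  ... | yes c≡0 = ⊥-elim (<⇒≢ 1≤j (cycleDist≡0⇒≡ (≤-trans (s≤s z≤n) j<g) j<g c≡0))
  ... | no c≢0 = n≢0⇒n>0 c≢0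
  closer : ∀ {x} → InFirstTree m x → descDist g x old ≡ descDist g x new + c
  closer {(.0 , h , i')} (refl , i'≤m)
    rewrite descDist-≢ g 0 h i' j 1 (suc i) (<⇒≢ 1≤j) | descDist-other-branch g 0 h i' 1 k (<⇒≢ (≤-<-trans i'≤m m<k)) = refl
  farther : ∀ {x} → OtherRoot g x → descDist g x new ≤ descDist g x old + c
  farther (p , refl , 1≤p , p<g) rewrite descDist-≢ g p 0 0 0 1 k (<⇒≢ 1≤p ∘ sym) | descDist-root-leaf g p j i =
    s≤s (≤-trans (cycleDist-triangle g p j 0 p<g j<g (≤-trans (s≤s z≤n) j<g)) (+-monoʳ-≤ (cycleDist g p j) (≤-reflexive (cycleDist-sym g j 0))))
  column-T : columnSum g T old ≡ columnSum g T new + length T * c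
  column-T = trans (sum-map-congᴬ T (All.map closer allT))
                   (trans (sum-map-+ (λ x → descDist g x new) (λ _ → c) T) (cong (columnSum g T new +_) (sum-map-const c T)))
  column-R : columnSum g R new ≤ columnSum g R old + length R * c
  column-R = ≤-trans (sum-map-mono R (All.map farther allR))
                     (≤-reflexive (trans (sum-map-+ (λ x → descDist g x old) (λ _ → c) R) (cong (columnSum g R old +_) (sum-map-const c R))))
  R+g+2≤T : length R * c + (g + 2) ≤ length T * c
  R+g+2≤T = begin
    length R * c + (g + 2)     ≤⟨ +-monoʳ-≤ (length R * c) (≤-trans (≤-reflexive (sym (*-identityʳ (g + 2)))) (*-monoʳ-≤ (g + 2) 1≤c)) ⟩
    length R * c + (g + 2) * c ≡⟨ *-distribʳ-+ c (length R) (g + 2) ⟨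
    (length R + (g + 2)) * c   ≤⟨ *-monoˡ-≤ c T-large ⟩
    length T * c               ∎
  rearrange : ∀ a b d e → a + b + d + e ≡ a + (e + d) + b
  rearrange = solve-∀

leaves : ℕ → ℕ → List Descriptor
leaves s k = applyUpTo (λ i → (s , 1 , suc i)) k

pendants : ℕ → ℕ → List Descriptor
pendants s k = applyUpTo (λ i → (s , 2 , suc i)) k

tstarDescs : ℕ → ℕ → ℕ → List Descriptor
tstarDescs s a b = (s , 0 , 0) ∷ (leaves s (a + b) ++ pendants s a)

cycleRoots : ℕ → ℕ → List Descriptor
cycleRoots s zero = []
cycleRoots s (suc k) = (s , 0 , 0) ∷ cycleRoots (suc s) k

spokeLeaves : ℕ → List ℕ → List Descriptor
spokeLeaves s [] = []
spokeLeaves s (b ∷ bs) = leaves s b ++ spokeLeaves (suc s) bs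

treeDescs : ℕ → ℕ × ℕ → List Descriptor
treeDescs s q = applyUpTo (λ l → (s , localDesc q l)) (order q)

treeDescs-Tstar : ∀ s a b → treeDescs s (a , b) ≡ tstarDescs s a b
treeDescs-Tstar s a b = begin
  applyUpTo f (a + a + b + 1) ≡⟨ cong (applyUpTo f) (order-suc a b) ⟩
  f 0 ∷ applyUpTo (λ i → f (suc i)) (a + b + a) ≡⟨ cong (f 0 ∷_) (applyUpTo-+ (λ i → f (suc i)) (a + b) a) ⟩
  f 0 ∷ (applyUpTo (λ i → f (suc i)) (a + b) ++ applyUpTo (λ i → f (suc (a + b + i))) a)
    ≡⟨ cong₂ (λ x y → f 0 ∷ (x ++ y)) (applyUpTo-cong _ _ (a + b) (λ i lt → cong (s ,_) (localDesc-leaf a b (suc i) (s≤s z≤n) lt)))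
                                       (applyUpTo-cong _ _ a (λ i lt → cong (s ,_) (trans (cong (localDesc (a , b)) (sym (+-suc (a + b) i))) (localDesc-pendant a b (suc i) (s≤s z≤n) lt)))) ⟩
  tstarDescs s a b ∎
  where
  open ≡-Reasoning
  f : ℕ → Descriptor
  f l = (s , localDesc (a , b) l)

descriptors-∷ : ∀ s q ps → applyUpTo (descriptor s (q ∷ ps)) (vertexCount (q ∷ ps)) ≡ treeDescs s q ++ applyUpTo (descriptor (suc s) ps) (vertexCount ps)
descriptors-∷ s q ps = trans (applyUpTo-+ (descriptor s (q ∷ ps)) (order q) (vertexCount ps))
  (cong₂ _++_ (applyUpTo-cong _ _ (order q) (λ i lt → descriptor-here s q ps i lt))
              (applyUpTo-cong _ _ (vertexCount ps) (λ i _ → descriptor-there s q ps i)))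

swap3 : ∀ {A : Set} (x : A) (M R' MG : List A) → x ∷ (M ++ []) ++ (R' ++ MG) ↭ x ∷ (R' ++ (M ++ MG))
swap3 x M R' MG = prep x (↭-trans (↭-reflexive (trans (cong (_++ (R' ++ MG)) (++-identityʳ M)) (sym (++-assoc M R' MG))))
                  (↭-trans (Perm.++⁺ʳ MG (Perm.++-comm M R')) (↭-reflexive (++-assoc R' M MG))))

descriptors-spokes-↭ : ∀ s bs → applyUpTo (descriptor s (map spoke bs)) (vertexCount (map spoke bs)) ↭ cycleRoots s (length bs) ++ spokeLeaves s bs
descriptors-spokes-↭ s [] = ↭-refl
descriptors-spokes-↭ s (b ∷ bs) = ↭-trans (↭-reflexive (trans (descriptors-∷ s (0 , b) (map spoke bs)) (cong (_++ _) (treeDescs-Tstar s 0 b))))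
  (↭-trans (Perm.++⁺ˡ (tstarDescs s 0 b) (descriptors-spokes-↭ (suc s) bs)) (swap3 (s , 0 , 0) (leaves s b) (cycleRoots (suc s) (length bs)) (spokeLeaves (suc s) bs)))

spokeLeaves-replicate-0 : ∀ s m → spokeLeaves s (replicate m 0) ≡ []
spokeLeaves-replicate-0 s zero = refl
spokeLeaves-replicate-0 s (suc m) = spokeLeaves-replicate-0 (suc s) m

newLeaves : ℕ → ℕ → List Descriptor
newLeaves m t = applyUpTo (λ i → (0 , 1 , suc (m + i))) t

tstarDescs-+-↭ : ∀ a b t → tstarDescs 0 a (b + t) ↭ tstarDescs 0 a b ++ newLeaves (a + b) t
tstarDescs-+-↭ a b t = ↭-trans (↭-reflexive (cong (λ L → (0 , 0 , 0) ∷ (L ++ pendants 0 a)) e))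
   (prep (0 , 0 , 0) (↭-trans (↭-reflexive (++-assoc (leaves 0 (a + b)) (newLeaves (a + b) t) (pendants 0 a)))
     (↭-trans (Perm.++⁺ˡ (leaves 0 (a + b)) (Perm.++-comm (newLeaves (a + b) t) (pendants 0 a))) (↭-reflexive (sym (++-assoc (leaves 0 (a + b)) (pendants 0 a) (newLeaves (a + b) t)))))))
  where
  e : leaves 0 (a + (b + t)) ≡ leaves 0 (a + b) ++ newLeaves (a + b) t
  e = trans (cong (leaves 0) (sym (+-assoc a b t))) (applyUpTo-+ (λ i → (0 , 1 , suc i)) (a + b) t)

length-leaves : ∀ s k → length (leaves s k) ≡ k
length-leaves s k = length-applyUpTo _ k

length-spokeLeaves : ∀ s bs → length (spokeLeaves s bs) ≡ sum bs
length-spokeLeaves s [] = refl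
length-spokeLeaves s (b ∷ bs) = trans (length-++ (leaves s b)) (cong₂ _+_ (length-leaves s b) (length-spokeLeaves (suc s) bs))

length-cycleRoots : ∀ s k → length (cycleRoots s k) ≡ k
length-cycleRoots s zero = refl
length-cycleRoots s (suc k) = cong suc (length-cycleRoots (suc s) k)

length-tstarDescs : ∀ s a b → length (tstarDescs s a b) ≡ suc (a + b + a)
length-tstarDescs s a b = cong suc (trans (length-++ (leaves s (a + b))) (cong₂ _+_ (length-leaves s (a + b)) (length-applyUpTo _ a)))

tstarDescs-InFirstTree : ∀ a b → All (InFirstTree (a + b)) (tstarDescs 0 a b)
tstarDescs-InFirstTree a b = (refl , z≤n) ∷ ++⁺ (All-applyUpTo _ (a + b) (λ i lt → refl , lt)) (All-applyUpTo _ a (λ i lt → refl , ≤-trans lt (m≤m+n a b)))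

cycleRoots-OtherRoot : ∀ g s k → 1 ≤ s → s + k ≤ g → All (OtherRoot g) (cycleRoots s k)
cycleRoots-OtherRoot g s zero h1 h2 = []
cycleRoots-OtherRoot g s (suc k) h1 h2 =
  (s , refl , h1 , ≤-trans (s≤s (m≤m+n s k)) 1+s+k≤g) ∷ cycleRoots-OtherRoot g (suc s) k (s≤s z≤n) 1+s+k≤g
  where 1+s+k≤g = ≤-trans (≤-reflexive (sym (+-suc s k))) h2

spokeLeaves-SpokeLeaf : ∀ g s bs → 1 ≤ s → s + length bs ≤ g → All (SpokeLeaf g) (spokeLeaves s bs)
spokeLeaves-SpokeLeaf g s [] h1 h2 = []
spokeLeaves-SpokeLeaf g s (b ∷ bs) h1 h2 = ++⁺ (All-applyUpTo _ b (λ i lt → s , i , refl , h1 , sg))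
                                (spokeLeaves-SpokeLeaf g (suc s) bs (s≤s z≤n) (≤-trans (≤-reflexive (sym (+-suc s (length bs)))) h2))
  where sg : s < g
        sg = ≤-trans (≤-trans (s≤s (m≤m+n s (length bs))) (≤-reflexive (sym (+-suc s (length bs))))) h2

newLeaves-NewLeaf : ∀ m t → All (NewLeaf m) (newLeaves m t)
newLeaves-NewLeaf m t = All-applyUpTo _ t (λ i lt → suc (m + i) , refl , s≤s (m≤m+n m i))

length-newLeaves : ∀ m t → length (newLeaves m t) ≡ t
length-newLeaves m t = length-applyUpTo _ t

-- Comparison of G and H

sum≤length : ∀ bs → All (_≤ 1) bs → sum bs ≤ length bs
sum≤length []       []       = z≤n
sum≤length (b ∷ bs) (h ∷ hs) = +-mono-≤ h (sum≤length bs hs)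

shapeG : ℕ → ℕ → List ℕ → List (ℕ × ℕ)
shapeG a b bs = (a , b) ∷ map spoke bs

shapeH : ℕ → ℕ → List ℕ → List (ℕ × ℕ)
shapeH a b bs = (a , b + sum bs) ∷ map spoke (replicate (length bs) 0)

length-shape : ∀ a b bs → length ((a , b) ∷ map spoke bs) ≡ suc (length bs)
length-shape a b bs = cong suc (length-map spoke bs)

shape-large : ∀ a b bs → 3 ≤ suc (length bs) → suc (length bs) ≤ a →
  4 + length ((a , b) ∷ map spoke bs) ≤ vertexCount ((a , b) ∷ map spoke bs)
shape-large a b bs 3≤g g≤a = begin
  4 + length ((a , b) ∷ map spoke bs) ≡⟨ cong (4 +_) (length-shape a b bs) ⟩
  4 + g                               ≤⟨ +-monoˡ-≤ g (+-monoˡ-≤ 1 3≤g) ⟩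
  g + 1 + g                           ≤⟨ +-mono-≤ (+-monoˡ-≤ 1 g≤a) g≤a ⟩
  a + 1 + a                           ≡⟨ trans (+-comm (a + 1) a) (sym (+-assoc a a 1)) ⟩
  a + a + 1                           ≤⟨ +-monoˡ-≤ 1 (m≤m+n (a + a) b) ⟩
  order (a , b)                       ≤⟨ m≤m+n (order (a , b)) (vertexCount (map spoke bs)) ⟩
  vertexCount ((a , b) ∷ map spoke bs) ∎
  where
  open ≤-Reasoning
  g = suc (length bs)

common : ℕ → ℕ → ℕ → List Descriptor
common a b m = tstarDescs 0 a b ++ cycleRoots 1 m

descriptors-G-↭ : ∀ a b bs → applyUpTo (descriptor 0 (shapeG a b bs)) (vertexCount (shapeG a b bs)) ↭ common a b (length bs) ++ spokeLeaves 1 bs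
descriptors-G-↭ a b bs = ↭-trans (↭-reflexive (trans (descriptors-∷ 0 (a , b) (map spoke bs)) (cong (_++ _) (treeDescs-Tstar 0 a b))))
  (↭-trans (Perm.++⁺ˡ (tstarDescs 0 a b) (descriptors-spokes-↭ 1 bs))
           (↭-reflexive (sym (++-assoc (tstarDescs 0 a b) (cycleRoots 1 (length bs)) (spokeLeaves 1 bs)))))

descriptors-H-↭ : ∀ a b bs → applyUpTo (descriptor 0 (shapeH a b bs)) (vertexCount (shapeH a b bs)) ↭ common a b (length bs) ++ newLeaves (a + b) (sum bs)
descriptors-H-↭ a b bs = ↭-trans (↭-reflexive (trans (descriptors-∷ 0 (a , b + t) (map spoke (replicate m 0))) (cong (_++ applyUpTo (descriptor 1 (map spoke (replicate m 0))) (vertexCount (map spoke (replicate m 0))))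
                                                                                          (treeDescs-Tstar 0 a (b + t)))))
  (↭-trans (Perm.++⁺ˡ (tstarDescs 0 a (b + t)) (descriptors-spokes-↭ 1 (replicate m 0)))
  (↭-trans (↭-reflexive (cong (tstarDescs 0 a (b + t) ++_) (trans (cong₂ _++_ (cong (cycleRoots 1) (length-replicate m)) (spokeLeaves-replicate-0 1 m)) (++-identityʳ (cycleRoots 1 m)))))
  (↭-trans (Perm.++⁺ʳ (cycleRoots 1 m) (tstarDescs-+-↭ a b t))
  (↭-trans (↭-reflexive (++-assoc (tstarDescs 0 a b) (newLeaves (a + b) t) (cycleRoots 1 m)))
  (↭-trans (Perm.++⁺ˡ (tstarDescs 0 a b) (Perm.++-comm (newLeaves (a + b) t) (cycleRoots 1 m)))
           (↭-reflexive (sym (++-assoc (tstarDescs 0 a b) (cycleRoots 1 m) (newLeaves (a + b) t)))))))))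
  where
  m = length bs
  t = sum bs

2W-blockSum : ∀ ps L → 4 + length ps ≤ vertexCount ps → applyUpTo (descriptor 0 ps) (vertexCount ps) ↭ L →
  2 * W (unicyclic ps) ≡ blockSum (length ps) L L
2W-blockSum ps L bnd p = trans (2W-unicyclic ps bnd)
  (trans (cong (λ k → blockSum (length ps) (applyUpTo (descriptor 0 ps) k) (applyUpTo (descriptor 0 ps) k)) (n-unicyclic ps))
         (blockSum-↭ (length ps) p p))

spokeLeaves-gain : ∀ a b bs → suc (length bs) ≤ a →
  blockSum (suc (length bs)) (common a b (length bs)) (newLeaves (a + b) (sum bs)) + sum bs * (suc (length bs) + 2)
    ≤ blockSum (suc (length bs)) (common a b (length bs)) (spokeLeaves 1 bs)
spokeLeaves-gain a b bs g≤a = begin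
  blockSum g A MH + t * (g + 2)
    ≡⟨ cong₂ _+_ (blockSum-columns g A MH) (cong (_* (g + 2)) (sym (length-newLeaves (a + b) t))) ⟩
  sum (map (columnSum g A) MH) + length MH * (g + 2)
    ≤⟨ sum-pairwise-≥ (columnSum g A) (g + 2) MG MH (trans (length-spokeLeaves 1 bs) (sym (length-newLeaves (a + b) t)))
         (spokeLeaves-SpokeLeaf g 1 bs ≤-refl ≤-refl) (newLeaves-NewLeaf (a + b) t)
         (spokeLeaf-gain g (a + b) (tstarDescs 0 a b) (cycleRoots 1 m) (tstarDescs-InFirstTree a b)
                         (cycleRoots-OtherRoot g 1 m ≤-refl ≤-refl) first-tree-large) ⟩
  sum (map (columnSum g A) MG)
    ≡⟨ blockSum-columns g A MG ⟨
  blockSum g A MG ∎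
  where
  open ≤-Reasoning
  m = length bs
  t = sum bs
  g = suc m
  A = common a b m
  MG = spokeLeaves 1 bs
  MH = newLeaves (a + b) t
  first-tree-large : length (cycleRoots 1 m) + (g + 2) ≤ length (tstarDescs 0 a b)
  first-tree-large = begin
    length (cycleRoots 1 m) + (g + 2) ≡⟨ cong (_+ (g + 2)) (length-cycleRoots 1 m) ⟩
    m + (g + 2)                       ≡⟨ arith m ⟩
    suc (g + g)                       ≤⟨ s≤s (+-mono-≤ g≤a g≤a) ⟩
    suc (a + a)                       ≤⟨ s≤s (+-monoˡ-≤ a (m≤m+n a b)) ⟩
    suc (a + b + a)                   ≡⟨ length-tstarDescs 0 a b ⟨
    length (tstarDescs 0 a b)         ∎
    where
    arith : ∀ m → m + (suc m + 2) ≡ suc (suc m + suc m)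
    arith = solve-∀

newLeaves-blockSum≤ : ∀ g m t → blockSum g (newLeaves m t) (newLeaves m t) ≤ t * (t * 2)
newLeaves-blockSum≤ g m t =
  ≤-trans (blockSum-bounded g 2 L L (All.map (λ x → All.map (≤2 x) (newLeaves-NewLeaf m t)) (newLeaves-NewLeaf m t)))
          (≤-reflexive (cong₂ (λ u v → u * (v * 2)) (length-newLeaves m t) (length-newLeaves m t)))
  where
  L = newLeaves m t
  ≤2 : ∀ {x y} → NewLeaf m x → NewLeaf m y → descDist g x y ≤ 2
  ≤2 (k , refl , _) (k' , refl , _) = ≤-trans (descDist≤ g 0 1 k 0 1 k') (≤-reflexive (cong (2 +_) (cycleDist-refl g 0)))

graphG : ℕ → ℕ → List ℕ → Graph
graphG a b bs = U (Tstar a b ∷ map (Tstar 0) bs)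

graphH : ℕ → ℕ → List ℕ → Graph
graphH a b bs = U (Tstar a (b + sum bs) ∷ replicate (length bs) (Tstar 0 0))

graphG≡unicyclic : ∀ a b bs → graphG a b bs ≡ unicyclic (shapeG a b bs)
graphG≡unicyclic a b bs = cong (λ ts → U (Tstar a b ∷ ts)) (map-∘ bs)

graphH≡unicyclic : ∀ a b bs → graphH a b bs ≡ unicyclic (shapeH a b bs)
graphH≡unicyclic a b bs = cong (λ ts → U (Tstar a (b + sum bs) ∷ ts))
  (trans (sym (map-replicate (Tstar 0) (length bs) 0)) (map-∘ (replicate (length bs) 0)))

-- With t = sum bs leaves moved, 2 W(G) - 2 W(H) ≥ 2 t (g + 2) - t (2 t) ≥ 6 t, because t ≤ g - 1.
W-gap : ∀ a b bs → 3 ≤ suc (length bs) → suc (length bs) ≤ a → All (_≤ 1) bs →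
  W (graphH a b bs) + 3 * sum bs ≤ W (graphG a b bs)
W-gap a b bs 3≤g g≤a bs≤1 =
  subst₂ (λ G H → W H + 3 * sum bs ≤ W G) (sym (graphG≡unicyclic a b bs)) (sym (graphH≡unicyclic a b bs)) (*-cancelˡ-≤ 2 (begin
  2 * (W GH + 3 * t)                     ≡⟨ *-distribˡ-+ 2 (W GH) (3 * t) ⟩
  2 * W GH + 2 * (3 * t)                 ≡⟨ cong (_+ 2 * (3 * t)) 2W-H ⟩
  X + 2 * Y + Q + 2 * (3 * t)            ≤⟨ +-monoˡ-≤ _ (+-monoʳ-≤ (X + 2 * Y) (newLeaves-blockSum≤ g (a + b) t)) ⟩
  X + 2 * Y + t * (t * 2) + 2 * (3 * t)  ≤⟨ quadratic ⟩
  X + 2 * (Y + t * (g + 2))              ≤⟨ +-monoʳ-≤ X (*-monoʳ-≤ 2 (spokeLeaves-gain a b bs g≤a)) ⟩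
  X + 2 * Z                              ≤⟨ m≤m+n (X + 2 * Z) R ⟩
  X + 2 * Z + R                          ≡⟨ 2W-G ⟨
  2 * W GG                               ∎))
  where
  open ≤-Reasoning
  m = length bs
  t = sum bs
  g = suc m
  A = common a b m
  MG = spokeLeaves 1 bs
  MH = newLeaves (a + b) t
  GG = unicyclic (shapeG a b bs)
  GH = unicyclic (shapeH a b bs)
  X = blockSum g A A
  Y = blockSum g A MH
  Q = blockSum g MH MH
  Z = blockSum g A MG
  R = blockSum g MG MG
  length-shapeH : length (shapeH a b bs) ≡ g
  length-shapeH = trans (length-shape a (b + t) (replicate m 0)) (cong suc (length-replicate m))
  shapeH-large : 4 + length (shapeH a b bs) ≤ vertexCount (shapeH a b bs)
  shapeH-large = shape-large a (b + t) (replicate m 0)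
    (subst (λ k → 3 ≤ suc k) (sym (length-replicate m)) 3≤g) (subst (λ k → suc k ≤ a) (sym (length-replicate m)) g≤a)
  2W-G : 2 * W GG ≡ X + 2 * Z + R
  2W-G = trans (2W-blockSum (shapeG a b bs) (A ++ MG) (shape-large a b bs 3≤g g≤a) (descriptors-G-↭ a b bs))
               (trans (cong (λ k → blockSum k (A ++ MG) (A ++ MG)) (length-shape a b bs)) (blockSum-++ g A MG))
  2W-H : 2 * W GH ≡ X + 2 * Y + Q
  2W-H = trans (2W-blockSum (shapeH a b bs) (A ++ MH) shapeH-large (descriptors-H-↭ a b bs))
               (trans (cong (λ k → blockSum k (A ++ MH) (A ++ MH)) length-shapeH) (blockSum-++ g A MH))
  quadratic : X + 2 * Y + t * (t * 2) + 2 * (3 * t) ≤ X + 2 * (Y + t * (g + 2))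
  quadratic = begin
    X + 2 * Y + t * (t * 2) + 2 * (3 * t) ≡⟨ expand₁ X Y t ⟩
    X + 2 * Y + 2 * (t * (t + 3))         ≤⟨ +-monoʳ-≤ (X + 2 * Y) (*-monoʳ-≤ 2 (*-monoʳ-≤ t (+-monoˡ-≤ 3 (sum≤length bs bs≤1)))) ⟩
    X + 2 * Y + 2 * (t * (m + 3))         ≡⟨ expand₂ X Y t m ⟩
    X + 2 * (Y + t * (g + 2))             ∎
    where
    expand₁ : ∀ X Y t → X + 2 * Y + t * (t * 2) + 2 * (3 * t) ≡ X + 2 * Y + 2 * (t * (t + 3))
    expand₁ = solve-∀
    expand₂ : ∀ X Y t m → X + 2 * Y + 2 * (t * (m + 3)) ≡ X + 2 * (Y + t * (suc m + 2))
    expand₂ = solve-∀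

graphG≡graphH : ∀ a b bs → sum bs ≡ 0 → graphG a b bs ≡ graphH a b bs
graphG≡graphH a b bs t≡0 rewrite t≡0 | +-identityʳ b = cong (λ ts → U (Tstar a b ∷ ts)) (spokes≡ bs t≡0)
  where
  spokes≡ : ∀ bs → sum bs ≡ 0 → map (Tstar 0) bs ≡ replicate (length bs) (Tstar 0 0)
  spokes≡ []       _   = refl
  spokes≡ (b ∷ bs) t≡0 = cong₂ _∷_ (cong (Tstar 0) (m+n≡0⇒m≡0 b t≡0)) (spokes≡ bs (m+n≡0⇒n≡0 b t≡0))

W-Iso : ∀ a b bs → 3 ≤ suc (length bs) → suc (length bs) ≤ a → Iso (graphG a b bs) (graphH a b bs) →
  W (graphG a b bs) ≡ W (graphH a b bs)
W-Iso a b bs 3≤g g≤a iso = *-cancelˡ-≡ _ _ 2 (begin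
  2 * W (graphG a b bs)          ≡⟨ cong (λ G → 2 * W G) (graphG≡unicyclic a b bs) ⟩
  2 * W (unicyclic (shapeG a b bs)) ≡⟨ 2W≡distanceSum (shapeG a b bs) (shape-large a b bs 3≤g g≤a) ⟩
  distanceSum (unicyclic (shapeG a b bs)) ≡⟨ cong distanceSum (graphG≡unicyclic a b bs) ⟨
  distanceSum (graphG a b bs)    ≡⟨ distanceSum-Iso _ _ iso ⟩
  distanceSum (graphH a b bs)    ≡⟨ cong distanceSum (graphH≡unicyclic a b bs) ⟩
  distanceSum (unicyclic (shapeH a b bs)) ≡⟨ 2W≡distanceSum (shapeH a b bs) shapeH-large ⟨
  2 * W (unicyclic (shapeH a b bs)) ≡⟨ cong (λ G → 2 * W G) (graphH≡unicyclic a b bs) ⟨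
  2 * W (graphH a b bs)          ∎)
  where
  open ≡-Reasoning
  m = length bs
  shapeH-large : 4 + length (shapeH a b bs) ≤ vertexCount (shapeH a b bs)
  shapeH-large = shape-large a (b + sum bs) (replicate m 0)
    (subst (λ k → 3 ≤ suc k) (sym (length-replicate m)) 3≤g) (subst (λ k → suc k ≤ a) (sym (length-replicate m)) g≤a)

girth≤a₁ : ∀ g a₁ β → 2 ∣ g → 3 * g ≤ 2 * β → a₁ + g / 2 ≡ β → g ≤ a₁
girth≤a₁ g a₁ β 2∣g 3g≤2β a₁+g/2≡β = *-cancelˡ-≤ 2 (+-cancelʳ-≤ g _ _ (begin
  2 * g + g              ≡⟨ +-comm (2 * g) g ⟩
  3 * g                  ≤⟨ 3g≤2β ⟩
  2 * β                  ≡⟨ cong (2 *_) a₁+g/2≡β ⟨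
  2 * (a₁ + g / 2)       ≡⟨ *-distribˡ-+ 2 a₁ (g / 2) ⟩
  2 * a₁ + 2 * (g / 2)   ≡⟨ cong (2 * a₁ +_) (m*[n/m]≡n 2∣g) ⟩
  2 * a₁ + g             ∎))
  where open ≤-Reasoning

lemma3p6 : (g a₁ b₁ β : ℕ) (bs : List ℕ) →
    3 ≤ g → 2 ∣ g → suc (length bs) ≡ g → All (_≤ 1) bs →
    MatchingNumber (U (Tstar a₁ b₁ ∷ map (Tstar 0) bs)) β →
    3 * g ≤ 2 * β → a₁ + g / 2 ≡ β →
    (W (U (Tstar a₁ (b₁ + sum bs) ∷ replicate (length bs) (Tstar 0 0)))
    ≤ W (U (Tstar a₁ b₁ ∷ map (Tstar 0) bs)))
    × ((W (U (Tstar a₁ b₁ ∷ map (Tstar 0) bs))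
    ≡ W (U (Tstar a₁ (b₁ + sum bs) ∷ replicate (length bs) (Tstar 0 0))))
    ⇔ Iso (U (Tstar a₁ b₁ ∷ map (Tstar 0) bs))
    (U (Tstar a₁ (b₁ + sum bs) ∷ replicate (length bs) (Tstar 0 0))))
lemma3p6 g a₁ b₁ β bs 3≤g 2∣g refl bs≤1 _ 3g≤2β a₁+g/2≡β = W-H≤W-G , mk⇔ equal⇒Iso (W-Iso a₁ b₁ bs 3≤g g≤a₁)
  where
  g≤a₁ = girth≤a₁ g a₁ β 2∣g 3g≤2β a₁+g/2≡β
  gap = W-gap a₁ b₁ bs 3≤g g≤a₁ bs≤1
  W-H≤W-G = ≤-trans (m≤m+n _ (3 * sum bs)) gap
  equal⇒Iso : W (graphG a₁ b₁ bs) ≡ W (graphH a₁ b₁ bs) → Iso (graphG a₁ b₁ bs) (graphH a₁ b₁ bs)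
  equal⇒Iso eq = subst (Iso (graphG a₁ b₁ bs)) (graphG≡graphH a₁ b₁ bs t≡0) (↔-id _ , λ u v → ⇔-id _)
    where
    t≡0 : sum bs ≡ 0
    t≡0 = n≤0⇒n≡0 (≤-trans (m≤n*m (sum bs) 3)
      (+-cancelˡ-≤ (W (graphH a₁ b₁ bs)) _ 0 (≤-trans gap (≤-reflexive (trans eq (sym (+-identityʳ _)))))))
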